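{- Let $D(x)$ be the period-doubling continued fraction. Then $$D(x)\equiv 1-\sum_{i,j=0}^{\infty}x^{2^i+2^j-1}+2\sum_{k=0}^{\infty}x^{2^{2k+1}-1}\Bigl(1+\sum_{j=0}^{\infty}x^{2^j}\Bigr)\pmod 4,$$ where the first sum runs over all ordered pairs $(i,j)$ of nonnegative integers.
   Context: Period-doubling sequence: $s_{2n}=1$, $s_{2n+1}=-s_n$ for $n\ge0$. $D(x)\in\mathbb{Z}[[x]]$ is the Stieltjes continued fraction $s_0/(1+s_1x/(1+s_2x/(1+\cdots)))$, i.e. the $x$-adic limit of its finite truncations $s_0/(1+s_1x/(1+\cdots/(1+s_nx)))$. Congruence modulo 4 is coefficientwise. -}

module Defs where

open import Data.Nat as ℕ using (ℕ; zero; suc; _≤_; ⌊_/2⌋; _^_; _∸_)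
open import Data.Bool using (Bool; true; false; if_then_else_)
open import Data.Integer as ℤ using (ℤ; +_; -_; _-_)
open import Data.Integer.Divisibility using (_∣_)
open import Relation.Binary.PropositionalEquality using (_≡_)
open import Relation.Nullary.Decidable using (⌊_⌋)
open import Data.Product using (∃)

-- Period-doubling sequence: s (2n) = 1, s (2n+1) = - s n  (n ≥ 0).

isEven : ℕ → Bool
isEven zero          = true
isEven (suc zero)    = false
isEven (suc (suc n)) = isEven n

-- fuel-driven recursion; fuel (n+1) suffices for argument n since ⌊n/2⌋ < n+1
sAux : ℕ → ℕ → ℤ
sAux zero    n = + 1
sAux (suc f) n = if isEven n then + 1 else - sAux f ⌊ n /2⌋

s : ℕ → ℤ
s n = sAux (suc n) n

Series : Set
Series = ℕ → ℤ

sumBelow : ℕ → (ℕ → ℤ) → ℤ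
sumBelow zero    f = + 0
sumBelow (suc n) f = sumBelow n f ℤ.+ f n

one : Series
one zero    = + 1
one (suc _) = + 0

scale : ℤ → Series → Series
scale c F n = c ℤ.* F n

neg : Series → Series
neg F n = - F n

shiftX : Series → Series
shiftX F zero    = + 0
shiftX F (suc n) = F n

mul : Series → Series → Series
mul F G n = sumBelow (suc n) (λ i → F i ℤ.* G (n ∸ i))

pow : Series → ℕ → Series
pow F zero    = one
pow F (suc k) = mul F (pow F k)

-- inv1 F = 1 / (1 + x F) = Σ_k (- x F)^k  (only k ≤ n contribute to x^n)
inv1 : Series → Series
inv1 F n = sumBelow (suc n) (λ k → pow (neg (shiftX F)) k n)

-- tailCF m d = 1 / (1 + s_m x / (1 + ⋯ / (1 + s_{m+d-1} x))) ; tailCF m 0 = 1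
tailCF : ℕ → ℕ → Series
tailCF m zero    = one
tailCF m (suc d) = inv1 (scale (s m) (tailCF (suc m) d))

truncCF : ℕ → Series
truncCF n = scale (s 0) (tailCF 1 n)

IsXAdicLimit : (ℕ → Series) → Series → Set
IsXAdicLimit T D = ∀ k → ∃ λ N → ∀ n → N ≤ n → T n k ≡ D k

countBelow : ℕ → (ℕ → Bool) → ℤ
countBelow b P = sumBelow b (λ i → if P i then + 1 else + 0)

eqℕ : ℕ → ℕ → Bool
eqℕ m n = ⌊ m ℕ.≟ n ⌋

-- coefficient of x^m in Σ_{i,j ≥ 0} x^(2^i + 2^j - 1):
-- number of ordered pairs (i , j) ∈ ℕ² with 2^i + 2^j - 1 = m
-- (such pairs have 2^i ≤ m+1 and 2^j ≤ m+1, hence i , j < m + 2)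
A : Series
A m = sumBelow (m ℕ.+ 2) (λ i → countBelow (m ℕ.+ 2)
        (λ j → eqℕ ((2 ^ i ℕ.+ 2 ^ j) ∸ 1) m))

-- coefficient of x^m in Σ_{k ≥ 0} x^(2^(2k+1) - 1) (1 + Σ_{j ≥ 0} x^(2^j)):
-- #{k : 2^(2k+1) - 1 = m} + #{(k , j) : 2^(2k+1) - 1 + 2^j = m}
-- (all such k , j are < m + 1)
B : Series
B m = countBelow (suc m) (λ k → eqℕ (2 ^ (2 ℕ.* k ℕ.+ 1) ∸ 1) m)
      ℤ.+ sumBelow (suc m) (λ k → countBelow (suc m)
            (λ j → eqℕ ((2 ^ (2 ℕ.* k ℕ.+ 1) ∸ 1) ℕ.+ 2 ^ j) m))

rhs : Series
rhs m = one m - A m ℤ.+ + 2 ℤ.* B m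

_≡ₛ_mod4 : Series → Series → Set
F ≡ₛ G mod4 = ∀ m → + 4 ∣ (F m - G m)

-- Write s = 1 - 2e with e ∈ {0, 1}, let P = Σᵢ x^(2^i), Q = Σₖ x^(2^(2k+1)), and let C be the series with
-- x C = x - P². Since P² ≡ P - x (mod 2), we get x C ≡ P (mod 2), hence C + x C² ≡ 1 (mod 4). With w = x C² and
-- E_m = Σₙ e(m+n) wⁿ, the series G_m = C (1 + 2 w E_m) then satisfy the recursion of the tails of the continued
-- fraction modulo 4, and any solution of that recursion agrees with the truncations; so D ≡ G₁ = C + 2 C E₀.
-- It remains to find x C E₀ ≡ P E₀ modulo 2. There e(2i+1) = 1 - e(i), e(2i+2) = 0 and the Frobenius
-- F(x)² ≡ F(x²) make (P/x) E₀ a solution of Z = P + P Z², as is (Q/x)(1 + P) by Q + Q² ≡ P²; this equation has a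
-- unique solution, so x C E₀ ≡ Q (1 + P) and x D ≡ x - P² + 2 Q (1 + P), which is x times the right-hand side.

module Submission where

open import Data.Bool using (true; false; if_then_else_)
open import Data.Empty using (⊥-elim)
open import Data.Maybe using (Maybe; just; nothing)
open import Data.Nat as ℕ using (ℕ; zero; suc; _≤_; _<_; z≤n; s≤s; _∸_; _^_; ⌊_/2⌋; NonZero)
import Data.Nat.Properties as ℕP
open import Data.Nat.Induction using (<-rec)
open import Data.Integer as ℤ using (ℤ; +_; -_; _-_; +0; _+_; _*_)
import Data.Integer.Properties as ℤP
open import Data.Integer.DivMod using (_%ℕ_; _/ℕ_; a≡a%ℕn+[a/ℕn]*n; n%ℕd<d)
open import Data.Integer.Divisibility.Signed as Signed using (divides; quotient) renaming (_∣_ to _∣ˢ_)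
open import Data.Integer.Tactic.RingSolver using (solve-∀)
open import Data.Product using (Σ; _×_; _,_)
open import Data.Sum using (_⊎_; inj₁; inj₂)
open import Function using (_∘_)
open import Level using (0ℓ)
open import Algebra.Bundles using (CommutativeRing)
open import Algebra.Bundles.Raw using (RawRing)
import Algebra.Solver.Ring.AlmostCommutativeRing as ACR
open import Relation.Binary.PropositionalEquality
open import Relation.Nullary using (yes; no)
import Relation.Binary.Reasoning.Setoid as SetoidReasoning

open import Defs

-- Finite sums

sumBelow-cong< : ∀ n {f g : ℕ → ℤ} → (∀ i → i < n → f i ≡ g i) → sumBelow n f ≡ sumBelow n g
sumBelow-cong< zero    eq = refl
sumBelow-cong< (suc n) eq =
  cong₂ _+_ (sumBelow-cong< n (λ i i<n → eq i (ℕP.m<n⇒m<1+n i<n))) (eq n ℕP.≤-refl)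

sumBelow-cong : ∀ n {f g : ℕ → ℤ} → (∀ i → f i ≡ g i) → sumBelow n f ≡ sumBelow n g
sumBelow-cong n eq = sumBelow-cong< n (λ i _ → eq i)

sumBelow-≡0 : ∀ n {f : ℕ → ℤ} → (∀ i → i < n → f i ≡ +0) → sumBelow n f ≡ +0
sumBelow-≡0 zero    _  = refl
sumBelow-≡0 (suc n) eq =
  cong₂ _+_ (sumBelow-≡0 n (λ i i<n → eq i (ℕP.m<n⇒m<1+n i<n))) (eq n ℕP.≤-refl)

sumBelow-+ : ∀ n (f g : ℕ → ℤ) → sumBelow n (λ i → f i + g i) ≡ sumBelow n f + sumBelow n g
sumBelow-+ zero    f g = refl
sumBelow-+ (suc n) f g =
  trans (cong (_+ (f n + g n)) (sumBelow-+ n f g)) (interchange (sumBelow n f) (sumBelow n g) (f n) (g n))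
  where
  interchange : ∀ a b c d → (a + b) + (c + d) ≡ (a + c) + (b + d)
  interchange = solve-∀

sumBelow-*ˡ : ∀ n c (f : ℕ → ℤ) → sumBelow n (λ i → c * f i) ≡ c * sumBelow n f
sumBelow-*ˡ zero    c f = sym (ℤP.*-zeroʳ c)
sumBelow-*ˡ (suc n) c f = trans (cong (_+ c * f n) (sumBelow-*ˡ n c f)) (sym (ℤP.*-distribˡ-+ c _ _))

sumBelow-*ʳ : ∀ n c (f : ℕ → ℤ) → sumBelow n (λ i → f i * c) ≡ sumBelow n f * c
sumBelow-*ʳ n c f =
  trans (sumBelow-cong n (λ i → ℤP.*-comm (f i) c)) (trans (sumBelow-*ˡ n c f) (ℤP.*-comm c _))

sumBelow-neg : ∀ n (f : ℕ → ℤ) → sumBelow n (λ i → - f i) ≡ - sumBelow n f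
sumBelow-neg zero    f = refl
sumBelow-neg (suc n) f =
  trans (cong (_+ - f n) (sumBelow-neg n f)) (sym (ℤP.neg-distrib-+ (sumBelow n f) (f n)))

sumBelow-suc : ∀ n (f : ℕ → ℤ) → sumBelow (suc n) f ≡ f 0 + sumBelow n (f ∘ suc)
sumBelow-suc zero    f = trans (ℤP.+-identityˡ (f 0)) (sym (ℤP.+-identityʳ (f 0)))
sumBelow-suc (suc n) f =
  trans (cong (_+ f (suc n)) (sumBelow-suc n f)) (ℤP.+-assoc (f 0) (sumBelow n (f ∘ suc)) (f (suc n)))

sumBelow-comm : ∀ a b (h : ℕ → ℕ → ℤ) →
  sumBelow a (λ i → sumBelow b (h i)) ≡ sumBelow b (λ j → sumBelow a (λ i → h i j))
sumBelow-comm zero    b h = sym (sumBelow-≡0 b (λ _ _ → refl))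
sumBelow-comm (suc a) b h =
  trans (cong (_+ sumBelow b (h a)) (sumBelow-comm a b h))
        (sym (sumBelow-+ b (λ j → sumBelow a (λ i → h i j)) (h a)))

sumBelow-pad : ∀ n m {f : ℕ → ℤ} → n ≤ m → (∀ i → n ≤ i → i < m → f i ≡ +0) →
  sumBelow m f ≡ sumBelow n f
sumBelow-pad n zero    z≤n   _    = refl
sumBelow-pad n (suc m) n≤1+m vanish with ℕP.m≤n⇒m<n∨m≡n n≤1+m
... | inj₁ (s≤s n≤m) =
  trans (cong₂ _+_ (sumBelow-pad n m n≤m (λ i n≤i i<m → vanish i n≤i (ℕP.m<n⇒m<1+n i<m))) (vanish m n≤m ℕP.≤-refl))
        (ℤP.+-identityʳ _)
... | inj₂ refl = refl

sumBelow-reverse : ∀ n (f : ℕ → ℤ) → sumBelow (suc n) f ≡ sumBelow (suc n) (λ i → f (n ∸ i))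
sumBelow-reverse zero    f = refl
sumBelow-reverse (suc n) f =
  trans (cong (_+ f (suc n)) (sumBelow-reverse n f))
        (trans (ℤP.+-comm (sumBelow (suc n) (λ i → f (n ∸ i))) (f (suc n)))
               (sym (sumBelow-suc (suc n) (λ i → f (suc n ∸ i)))))

sumBelow-triangle : ∀ n (a : ℕ → ℕ → ℤ) →
  sumBelow (suc n) (λ k → sumBelow (suc k) (λ i → a i k)) ≡
  sumBelow (suc n) (λ i → sumBelow (suc (n ∸ i)) (λ j → a i (i ℕ.+ j)))
sumBelow-triangle zero    a = refl
sumBelow-triangle (suc n) a = begin
    sumBelow (suc n) (λ k → sumBelow (suc k) (λ i → a i k)) + (column (suc n) + a (suc n) (suc n))
  ≡⟨ cong (_+ (column (suc n) + a (suc n) (suc n))) (sumBelow-triangle n a) ⟩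
    rows n + (column (suc n) + a (suc n) (suc n))
  ≡⟨ sym (ℤP.+-assoc (rows n) (column (suc n)) _) ⟩
    (rows n + column (suc n)) + a (suc n) (suc n)
  ≡⟨ cong₂ _+_ (sym (sumBelow-+ (suc n) _ _)) (sym (ℤP.+-identityˡ _)) ⟩
    sumBelow (suc n) (λ i → row n i + a i (suc n)) + (+0 + a (suc n) (suc n))
  ≡⟨ cong₂ _+_ (sumBelow-cong< (suc n) extend-row) diagonal ⟩
    rows (suc n)
  ∎
  where
  open ≡-Reasoning
  column : ℕ → ℤ
  column k = sumBelow k (λ i → a i (suc n))
  row : ℕ → ℕ → ℤ
  row n i = sumBelow (suc (n ∸ i)) (λ j → a i (i ℕ.+ j))
  rows : ℕ → ℤ
  rows n = sumBelow (suc n) (row n)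
  extend-row : ∀ i → i < suc n → row n i + a i (suc n) ≡ row (suc n) i
  extend-row i (s≤s i≤n) rewrite ℕP.+-∸-assoc 1 i≤n =
    cong (λ k → row n i + a i k) (sym (trans (ℕP.+-suc i (n ∸ i)) (cong suc (ℕP.m+[n∸m]≡n i≤n))))
  diagonal : +0 + a (suc n) (suc n) ≡ row (suc n) (suc n)
  diagonal rewrite ℕP.n∸n≡0 n | ℕP.+-identityʳ n = refl

sumBelow-parity : ∀ n (f : ℕ → ℤ) →
  sumBelow (n ℕ.+ n) f ≡ sumBelow n (λ k → f (k ℕ.+ k)) + sumBelow n (λ k → f (suc (k ℕ.+ k)))
sumBelow-parity zero    f = refl
sumBelow-parity (suc n) f rewrite ℕP.+-suc n n =
  trans (cong (λ z → z + f (n ℕ.+ n) + f (suc (n ℕ.+ n))) (sumBelow-parity n f)) 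
        (regroup (sumBelow n (λ k → f (k ℕ.+ k))) (sumBelow n (λ k → f (suc (k ℕ.+ k)))) (f (n ℕ.+ n)) (f (suc (n ℕ.+ n))))
  where
  regroup : ∀ a b c d → a + b + c + d ≡ (a + c) + (b + d)
  regroup = solve-∀

-- Congruences of integers

infix 4 _≡_[mod_]
record _≡_[mod_] (a b M : ℤ) : Set where
  constructor congruent
  field ∣-difference : M ∣ˢ a - b
open _≡_[mod_] public

≡⇒≡-mod : ∀ {M a b} → a ≡ b → a ≡ b [mod M ]
≡⇒≡-mod {M} {a} refl = congruent (subst (M ∣ˢ_) (sym (ℤP.+-inverseʳ a)) (divides +0 (sym (ℤP.*-zeroˡ M))))

≡-mod-sym : ∀ {M a b} → a ≡ b [mod M ] → b ≡ a [mod M ]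
≡-mod-sym {M} {a} {b} (congruent p) = congruent (subst (M ∣ˢ_) (negate a b) (Signed.∣m⇒∣-m p))
  where
  negate : ∀ a b → - (a - b) ≡ b - a
  negate = solve-∀

≡-mod-trans : ∀ {M a b c} → a ≡ b [mod M ] → b ≡ c [mod M ] → a ≡ c [mod M ]
≡-mod-trans {M} {a} {b} {c} (congruent p) (congruent q) =
  congruent (subst (M ∣ˢ_) (telescope a b c) (Signed.∣m∣n⇒∣m+n p q))
  where
  telescope : ∀ a b c → (a - b) + (b - c) ≡ a - c
  telescope = solve-∀

+-cong-mod : ∀ {M a b c d} → a ≡ b [mod M ] → c ≡ d [mod M ] → a + c ≡ b + d [mod M ]
+-cong-mod {M} {a} {b} {c} {d} (congruent p) (congruent q) =
  congruent (subst (M ∣ˢ_) (regroup a b c d) (Signed.∣m∣n⇒∣m+n p q))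
  where
  regroup : ∀ a b c d → (a - b) + (c - d) ≡ (a + c) - (b + d)
  regroup = solve-∀

neg-cong-mod : ∀ {M a b} → a ≡ b [mod M ] → - a ≡ - b [mod M ]
neg-cong-mod {M} {a} {b} (congruent p) = congruent (subst (M ∣ˢ_) (negate a b) (Signed.∣m⇒∣-m p))
  where
  negate : ∀ a b → - (a - b) ≡ (- a) - (- b)
  negate = solve-∀

*-cong-mod : ∀ {M a b c d} → a ≡ b [mod M ] → c ≡ d [mod M ] → a * c ≡ b * d [mod M ]
*-cong-mod {M} {a} {b} {c} {d} (congruent p) (congruent q) =
  congruent (subst (M ∣ˢ_) (split a b c d) (Signed.∣m∣n⇒∣m+n (Signed.∣m⇒∣m*n c p) (Signed.∣n⇒∣m*n b q)))
  where
  split : ∀ a b c d → (a - b) * c + b * (c - d) ≡ a * c - b * d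
  split = solve-∀

sumBelow-cong-mod : ∀ {M} n {f g : ℕ → ℤ} → (∀ i → i < n → f i ≡ g i [mod M ]) →
  sumBelow n f ≡ sumBelow n g [mod M ]
sumBelow-cong-mod zero    _  = ≡⇒≡-mod refl
sumBelow-cong-mod (suc n) eq =
  +-cong-mod (sumBelow-cong-mod n (λ i i<n → eq i (ℕP.m<n⇒m<1+n i<n))) (eq n ℕP.≤-refl)

≡-mod-0⇒≡ : ∀ {a b} → a ≡ b [mod +0 ] → a ≡ b
≡-mod-0⇒≡ {a} {b} (congruent (divides q a-b≡q*0)) =
  trans (sym (cancel a b)) (trans (cong (_+ b) (trans a-b≡q*0 (ℤP.*-zeroʳ q))) (ℤP.+-identityˡ b))
  where
  cancel : ∀ a b → (a - b) + b ≡ a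
  cancel = solve-∀

square-mod-2 : ∀ a → a * a ≡ a [mod + 2 ]
square-mod-2 a with a %ℕ 2 | a /ℕ 2 | a≡a%ℕn+[a/ℕn]*n a 2 | n%ℕd<d a 2
... | 0           | q | refl | _ = congruent (divides (q * q * + 2 - q) (even q))
  where
  even : ∀ q → (+ 0 + q * + 2) * (+ 0 + q * + 2) - (+ 0 + q * + 2) ≡ (q * q * + 2 - q) * + 2
  even = solve-∀
... | 1           | q | refl | _ = congruent (divides (q * q * + 2 + q) (odd q))
  where
  odd : ∀ q → (+ 1 + q * + 2) * (+ 1 + q * + 2) - (+ 1 + q * + 2) ≡ (q * q * + 2 + q) * + 2
  odd = solve-∀
... | suc (suc r) | _ | _    | s≤s (s≤s ())

-- Formal power series and their congruences

infix  4 _≐_ _≈_[mod_]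
infixl 6 _+ˢ_ _-ˢ_
infixl 7 _*ˢ_
infix  8 -ˢ_

_+ˢ_ : Series → Series → Series
(F +ˢ G) k = F k + G k

-ˢ_ : Series → Series
-ˢ_ = neg

_-ˢ_ : Series → Series → Series
F -ˢ G = F +ˢ (-ˢ G)

_*ˢ_ : Series → Series → Series
_*ˢ_ = mul

cst : ℤ → Series
cst c zero    = c
cst c (suc _) = +0

𝟎 𝟏 : Series
𝟎 = cst +0
𝟏 = cst (+ 1)

_≐_ : Series → Series → Set
F ≐ G = ∀ k → F k ≡ G k

record _≈_[mod_] (F G : Series) (M : ℤ) : Set where
  constructor coeffwise
  field coeff : ∀ k → F k ≡ G k [mod M ]
open _≈_[mod_] public

≐-sym : ∀ {F G} → F ≐ G → G ≐ F
≐-sym F≐G k = sym (F≐G k)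

≐-trans : ∀ {F G H} → F ≐ G → G ≐ H → F ≐ H
≐-trans F≐G G≐H k = trans (F≐G k) (G≐H k)

≐⇒≈ : ∀ {M F G} → F ≐ G → F ≈ G [mod M ]
≐⇒≈ F≐G = coeffwise (λ k → ≡⇒≡-mod (F≐G k))

≈-refl : ∀ {M F} → F ≈ F [mod M ]
≈-refl = ≐⇒≈ (λ _ → refl)

≈-sym : ∀ {M F G} → F ≈ G [mod M ] → G ≈ F [mod M ]
≈-sym F≈G = coeffwise (λ k → ≡-mod-sym (coeff F≈G k))

≈-trans : ∀ {M F G H} → F ≈ G [mod M ] → G ≈ H [mod M ] → F ≈ H [mod M ]
≈-trans F≈G G≈H = coeffwise (λ k → ≡-mod-trans (coeff F≈G k) (coeff G≈H k))

*ˢ-congᵖ : ∀ {F F' G G'} → F ≐ F' → G ≐ G' → F *ˢ G ≐ F' *ˢ G'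
*ˢ-congᵖ F≐F' G≐G' k = sumBelow-cong (suc k) (λ i → cong₂ _*_ (F≐F' i) (G≐G' (k ∸ i)))

*ˢ-comm : ∀ F G → F *ˢ G ≐ G *ˢ F
*ˢ-comm F G n = trans (sumBelow-reverse n (λ i → F i * G (n ∸ i)))
  (sumBelow-cong< (suc n) (λ i i<1+n →
    trans (cong (λ j → F (n ∸ i) * G j) (ℕP.m∸[m∸n]≡n (ℕP.≤-pred i<1+n))) (ℤP.*-comm (F (n ∸ i)) (G i))))

*ˢ-assoc : ∀ F G H → (F *ˢ G) *ˢ H ≐ F *ˢ (G *ˢ H)
*ˢ-assoc F G H n = begin
    sumBelow (suc n) (λ k → sumBelow (suc k) (λ i → F i * G (k ∸ i)) * H (n ∸ k))
  ≡⟨ sumBelow-cong (suc n) (λ k → sym (sumBelow-*ʳ (suc k) (H (n ∸ k)) (λ i → F i * G (k ∸ i)))) ⟩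
    sumBelow (suc n) (λ k → sumBelow (suc k) (λ i → F i * G (k ∸ i) * H (n ∸ k)))
  ≡⟨ sumBelow-triangle n (λ i k → F i * G (k ∸ i) * H (n ∸ k)) ⟩
    sumBelow (suc n) (λ i → sumBelow (suc (n ∸ i)) (λ j → F i * G ((i ℕ.+ j) ∸ i) * H (n ∸ (i ℕ.+ j))))
  ≡⟨ sumBelow-cong (suc n) (λ i → sumBelow-cong (suc (n ∸ i)) (λ j →
       trans (cong₂ (λ a b → F i * G a * H b) (ℕP.m+n∸m≡n i j) (sym (ℕP.∸-+-assoc n i j)))
             (ℤP.*-assoc (F i) (G j) (H (n ∸ i ∸ j))))) ⟩
    sumBelow (suc n) (λ i → sumBelow (suc (n ∸ i)) (λ j → F i * (G j * H (n ∸ i ∸ j))))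
  ≡⟨ sumBelow-cong (suc n) (λ i → sumBelow-*ˡ (suc (n ∸ i)) (F i) (λ j → G j * H (n ∸ i ∸ j))) ⟩
    (F *ˢ (G *ˢ H)) n
  ∎
  where open ≡-Reasoning

*ˢ-distribˡ-+ˢ : ∀ F G H → F *ˢ (G +ˢ H) ≐ F *ˢ G +ˢ F *ˢ H
*ˢ-distribˡ-+ˢ F G H n =
  trans (sumBelow-cong (suc n) (λ i → ℤP.*-distribˡ-+ (F i) (G (n ∸ i)) (H (n ∸ i)))) (sumBelow-+ (suc n) _ _)

*ˢ-distribʳ-+ˢ : ∀ F G H → (G +ˢ H) *ˢ F ≐ G *ˢ F +ˢ H *ˢ F
*ˢ-distribʳ-+ˢ F G H n =
  trans (sumBelow-cong (suc n) (λ i → ℤP.*-distribʳ-+ (F (n ∸ i)) (G i) (H i))) (sumBelow-+ (suc n) _ _)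

cst-*ˢ : ∀ a F → cst a *ˢ F ≐ scale a F
cst-*ˢ a F n = trans (sumBelow-suc n (λ i → cst a i * F (n ∸ i)))
  (trans (cong (λ z → a * F n + z) (sumBelow-≡0 n (λ i _ → ℤP.*-zeroˡ (F (n ∸ suc i))))) (ℤP.+-identityʳ (a * F n)))

*ˢ-identityˡ : ∀ F → 𝟏 *ˢ F ≐ F
*ˢ-identityˡ F n = trans (cst-*ˢ (+ 1) F n) (ℤP.*-identityˡ (F n))

*ˢ-identityʳ : ∀ F → F *ˢ 𝟏 ≐ F
*ˢ-identityʳ F = ≐-trans (*ˢ-comm F 𝟏) (*ˢ-identityˡ F)

*ˢ-constantˡ : ∀ F G → F 0 ≡ +0 → (F *ˢ G) 0 ≡ +0
*ˢ-constantˡ F G F₀≡0 = trans (ℤP.+-identityˡ _) (trans (cong (_* G 0) F₀≡0) (ℤP.*-zeroˡ (G 0)))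

+ˢ-cong : ∀ {M F F' G G'} → F ≈ F' [mod M ] → G ≈ G' [mod M ] → F +ˢ G ≈ F' +ˢ G' [mod M ]
+ˢ-cong F≈F' G≈G' = coeffwise (λ k → +-cong-mod (coeff F≈F' k) (coeff G≈G' k))

+ˢ-congˡ : ∀ {M} F {G G'} → G ≈ G' [mod M ] → F +ˢ G ≈ F +ˢ G' [mod M ]
+ˢ-congˡ F = +ˢ-cong (≈-refl {F = F})

+ˢ-congʳ : ∀ {M} G {F F'} → F ≈ F' [mod M ] → F +ˢ G ≈ F' +ˢ G [mod M ]
+ˢ-congʳ G F≈F' = +ˢ-cong F≈F' (≈-refl {F = G})

-ˢ-cong : ∀ {M F F'} → F ≈ F' [mod M ] → -ˢ F ≈ -ˢ F' [mod M ]
-ˢ-cong F≈F' = coeffwise (λ k → neg-cong-mod (coeff F≈F' k))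

*ˢ-cong≤ : ∀ {M} F F' G G' k → (∀ i → i ≤ k → F i ≡ F' i [mod M ]) → (∀ i → i ≤ k → G i ≡ G' i [mod M ]) →
  (F *ˢ G) k ≡ (F' *ˢ G') k [mod M ]
*ˢ-cong≤ F F' G G' k F≈F' G≈G' =
  sumBelow-cong-mod (suc k) (λ i i<1+k → *-cong-mod (F≈F' i (ℕP.≤-pred i<1+k)) (G≈G' (k ∸ i) (ℕP.m∸n≤m k i)))

*ˢ-cong : ∀ {M F F' G G'} → F ≈ F' [mod M ] → G ≈ G' [mod M ] → F *ˢ G ≈ F' *ˢ G' [mod M ]
*ˢ-cong {F = F} {F'} {G} {G'} F≈F' G≈G' =
  coeffwise (λ k → *ˢ-cong≤ F F' G G' k (λ i _ → coeff F≈F' i) (λ i _ → coeff G≈G' i))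

*ˢ-congˡ : ∀ {M} F {G G'} → G ≈ G' [mod M ] → F *ˢ G ≈ F *ˢ G' [mod M ]
*ˢ-congˡ F = *ˢ-cong (≈-refl {F = F})

*ˢ-congʳ : ∀ {M} G {F F'} → F ≈ F' [mod M ] → F *ˢ G ≈ F' *ˢ G [mod M ]
*ˢ-congʳ G F≈F' = *ˢ-cong F≈F' (≈-refl {F = G})

*ˢ-cong< : ∀ {M} F F' G G' k → F 0 ≡ +0 → F' 0 ≡ +0 → (∀ i → i ≤ k → F i ≡ F' i [mod M ]) →
  (∀ i → i < k → G i ≡ G' i [mod M ]) → (F *ˢ G) k ≡ (F' *ˢ G') k [mod M ]
*ˢ-cong< {M} F F' G G' k F₀≡0 F'₀≡0 F≈F' G≈G' = sumBelow-cong-mod (suc k) term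
  where
  term : ∀ i → i < suc k → F i * G (k ∸ i) ≡ F' i * G' (k ∸ i) [mod M ]
  term zero    _ rewrite F₀≡0 | F'₀≡0 = ≡⇒≡-mod refl
  term (suc i) (s≤s i<k) = *-cong-mod (F≈F' (suc i) i<k) (G≈G' (k ∸ suc i) (k∸1+i<k i<k))
    where
    k∸1+i<k : ∀ {k i} → i < k → k ∸ suc i < k
    k∸1+i<k {suc k} {i} _ = s≤s (ℕP.m∸n≤m k i)

seriesRing : ℤ → CommutativeRing 0ℓ 0ℓ
seriesRing M = record
  { Carrier = Series ; _≈_ = λ F G → F ≈ G [mod M ]
  ; _+_ = _+ˢ_ ; _*_ = _*ˢ_ ; -_ = -ˢ_ ; 0# = 𝟎 ; 1# = 𝟏
  ; isCommutativeRing = record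
    { isRing = record
      { +-isAbelianGroup = record
        { isGroup = record
          { isMonoid = record
            { isSemigroup = record
              { isMagma = record
                { isEquivalence = record { refl = ≈-refl ; sym = ≈-sym ; trans = ≈-trans }
                ; ∙-cong = +ˢ-cong }
              ; assoc = λ F G H → ≐⇒≈ (λ k → ℤP.+-assoc (F k) (G k) (H k)) }
            ; identity = (λ F → ≐⇒≈ (λ { zero → ℤP.+-identityˡ (F 0) ; (suc k) → ℤP.+-identityˡ (F (suc k)) }))
                       , (λ F → ≐⇒≈ (λ { zero → ℤP.+-identityʳ (F 0) ; (suc k) → ℤP.+-identityʳ (F (suc k)) })) }
          ; inverse = (λ F → ≐⇒≈ (λ { zero → ℤP.+-inverseˡ (F 0) ; (suc k) → ℤP.+-inverseˡ (F (suc k)) }))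
                    , (λ F → ≐⇒≈ (λ { zero → ℤP.+-inverseʳ (F 0) ; (suc k) → ℤP.+-inverseʳ (F (suc k)) }))
          ; ⁻¹-cong = -ˢ-cong }
        ; comm = λ F G → ≐⇒≈ (λ k → ℤP.+-comm (F k) (G k)) }
      ; *-cong = *ˢ-cong
      ; *-assoc = λ F G H → ≐⇒≈ (*ˢ-assoc F G H)
      ; *-identity = (λ F → ≐⇒≈ (*ˢ-identityˡ F)) , (λ F → ≐⇒≈ (*ˢ-identityʳ F))
      ; distrib = (λ F G H → ≐⇒≈ (*ˢ-distribˡ-+ˢ F G H)) , (λ F G H → ≐⇒≈ (*ˢ-distribʳ-+ˢ F G H)) }
    ; *-comm = λ F G → ≐⇒≈ (*ˢ-comm F G) } }

module ≈-Reasoning (M : ℤ) = SetoidReasoning (CommutativeRing.setoid (seriesRing M))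

cst-cong : ∀ {M a b} → a ≡ b [mod M ] → cst a ≈ cst b [mod M ]
cst-cong a≡b = coeffwise (λ { zero → a≡b ; (suc k) → ≡⇒≡-mod refl })

cst-+ : ∀ a b → cst (a + b) ≐ cst a +ˢ cst b
cst-+ a b zero    = refl
cst-+ a b (suc k) = refl

cst-neg : ∀ a → cst (- a) ≐ -ˢ cst a
cst-neg a zero    = refl
cst-neg a (suc k) = refl

cst-* : ∀ a b → cst (a * b) ≐ cst a *ˢ cst b
cst-* a b zero    = sym (cst-*ˢ a (cst b) zero)
cst-* a b (suc k) = sym (trans (cst-*ˢ a (cst b) (suc k)) (ℤP.*-zeroʳ a))

-- Ring normalisation in (ℤ/M)[[x]]: coefficients are reduced mod M, so that e.g. F + F ≈ 𝟎 is provable for M = 2.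
module SeriesSolver (M : ℕ) .{{_ : NonZero M}} where

  reduce : ℤ → ℤ
  reduce a = + (a %ℕ M)

  reduce-correct : ∀ a → cst (reduce a) ≈ cst a [mod + M ]
  reduce-correct a = cst-cong (congruent (divides (- (a /ℕ M)) (quotient-form (a %ℕ M) (a /ℕ M) (a≡a%ℕn+[a/ℕn]*n a M))))
    where
    quotient-form : ∀ r q → a ≡ + r + q * + M → + r - a ≡ - q * + M
    quotient-form r q refl = cancel (+ r) q (+ M)
      where
      cancel : ∀ r q m → r - (r + q * m) ≡ - q * m
      cancel = solve-∀

  coefficients : RawRing 0ℓ 0ℓ
  coefficients = record
    { Carrier = ℤ ; _≈_ = _≡_
    ; _+_ = λ a b → reduce (a + b) ; _*_ = λ a b → reduce (a * b) ; -_ = λ a → reduce (- a)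
    ; 0# = +0 ; 1# = reduce (+ 1) }

  constants : coefficients ACR.-Raw-AlmostCommutative⟶ ACR.fromCommutativeRing (seriesRing (+ M))
  constants = record
    { ⟦_⟧    = cst
    ; +-homo = λ a b → ≈-trans (reduce-correct (a + b)) (≐⇒≈ (cst-+ a b))
    ; *-homo = λ a b → ≈-trans (reduce-correct (a * b)) (≐⇒≈ (cst-* a b))
    ; -‿homo = λ a → ≈-trans (reduce-correct (- a)) (≐⇒≈ (cst-neg a))
    ; 0-homo = ≈-refl
    ; 1-homo = reduce-correct (+ 1) }

  equal? : ∀ a b → Maybe (cst a ≈ cst b [mod + M ])
  equal? a b with a ℤ.≟ b
  ... | yes refl = just ≈-refl
  ... | no _     = nothing

  open import Algebra.Solver.Ring coefficients (ACR.fromCommutativeRing (seriesRing (+ M))) constants equal? public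

module Mod2 = SeriesSolver 2
module Mod4 = SeriesSolver 4

-- The variable x and uniqueness of fixed points

X : Series
X (suc zero)    = + 1
X zero          = +0
X (suc (suc _)) = +0

shiftX≐X*ˢ : ∀ F → shiftX F ≐ X *ˢ F
shiftX≐X*ˢ F zero    = refl
shiftX≐X*ˢ F (suc k) = sym (begin
    sumBelow (suc (suc k)) (λ i → X i * F (suc k ∸ i))
  ≡⟨ sumBelow-suc (suc k) (λ i → X i * F (suc k ∸ i)) ⟩
    +0 + sumBelow (suc k) (λ i → X (suc i) * F (k ∸ i))
  ≡⟨ ℤP.+-identityˡ _ ⟩
    sumBelow (suc k) (λ i → X (suc i) * F (k ∸ i))
  ≡⟨ sumBelow-suc k (λ i → X (suc i) * F (k ∸ i)) ⟩
    + 1 * F k + sumBelow k (λ i → +0 * F (k ∸ suc i))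
  ≡⟨ cong₂ _+_ (ℤP.*-identityˡ (F k)) (sumBelow-≡0 k (λ i _ → ℤP.*-zeroˡ (F (k ∸ suc i)))) ⟩
    F k + +0
  ≡⟨ ℤP.+-identityʳ (F k) ⟩
    F k
  ∎)
  where open ≡-Reasoning

X-cancel : ∀ {M F G} → X *ˢ F ≈ X *ˢ G [mod M ] → F ≈ G [mod M ]
X-cancel {M} {F} {G} XF≈XG = coeffwise (λ k →
  subst₂ (λ a b → a ≡ b [mod M ]) (sym (shiftX≐X*ˢ F (suc k))) (sym (shiftX≐X*ˢ G (suc k))) (coeff XF≈XG (suc k)))

affine-fixpoint-unique : ∀ {M} {I : Set} (U V : I → Series) (σ : I → I) (c : I → ℤ) (v : Series) → v 0 ≡ +0 →
  (∀ i → U i ≈ cst (c i) +ˢ v *ˢ U (σ i) [mod M ]) → (∀ i → V i ≈ cst (c i) +ˢ v *ˢ V (σ i) [mod M ]) →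
  ∀ i → U i ≈ V i [mod M ]
affine-fixpoint-unique {M} U V σ c v v₀≡0 U-fix V-fix i = coeffwise (λ k → <-rec Agree step k i)
  where
  Agree : ℕ → Set
  Agree k = ∀ i → U i k ≡ V i k [mod M ]
  step : ∀ k → (∀ {j} → j < k → Agree j) → Agree k
  step k ih i = ≡-mod-trans (coeff (U-fix i) k) (≡-mod-trans
    (+-cong-mod (≡⇒≡-mod {a = cst (c i) k} refl) (*ˢ-cong< v v (U (σ i)) (V (σ i)) k v₀≡0 v₀≡0 (λ _ _ → ≡⇒≡-mod refl) (λ j j<k → ih j<k (σ i))))
    (≡-mod-sym (coeff (V-fix i) k)))

quadratic-fixpoint-unique : ∀ {M} (U V F G : Series) →
  U ≈ F +ˢ X *ˢ (G *ˢ U *ˢ U) [mod M ] → V ≈ F +ˢ X *ˢ (G *ˢ V *ˢ V) [mod M ] → U ≈ V [mod M ]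
quadratic-fixpoint-unique {M} U V F G U-fix V-fix = coeffwise (<-rec (λ k → U k ≡ V k [mod M ]) step)
  where
  step : ∀ k → (∀ {j} → j < k → U j ≡ V j [mod M ]) → U k ≡ V k [mod M ]
  step k ih = ≡-mod-trans (coeff U-fix k) (≡-mod-trans
    (+-cong-mod (≡⇒≡-mod {a = F k} refl) (*ˢ-cong< X X (G *ˢ U *ˢ U) (G *ˢ V *ˢ V) k refl refl (λ _ _ → ≡⇒≡-mod refl)
      (λ j j<k → *ˢ-cong≤ (G *ˢ U) (G *ˢ V) U V j
         (λ i i≤j → *ˢ-cong≤ G G U V i (λ _ _ → ≡⇒≡-mod refl) (λ l l≤i → ih (ℕP.≤-<-trans l≤i (ℕP.≤-<-trans i≤j j<k))))
         (λ i i≤j → ih (ℕP.≤-<-trans i≤j j<k)))))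
    (≡-mod-sym (coeff V-fix k)))

compose : (ℕ → ℤ) → Series → Series
compose f w k = sumBelow (suc k) (λ n → f n * pow w n k)

compose-cong : ∀ {f g} w → (∀ n → f n ≡ g n) → compose f w ≐ compose g w
compose-cong w f≡g k = sumBelow-cong (suc k) (λ n → cong (_* pow w n k) (f≡g n))

pow-vanishes : ∀ w → w 0 ≡ +0 → ∀ n k → k < n → pow w n k ≡ +0
pow-vanishes w w₀≡0 (suc n) k k<1+n = sumBelow-≡0 (suc k) term
  where
  term : ∀ i → i < suc k → w i * pow w n (k ∸ i) ≡ +0
  term zero    _ rewrite w₀≡0 = refl
  term (suc i) (s≤s i<k) =
    trans (cong (w (suc i) *_) (pow-vanishes w w₀≡0 n (k ∸ suc i) (k∸1+i<n k<1+n i<k))) (ℤP.*-zeroʳ (w (suc i)))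
    where
    k∸1+i<n : ∀ {k n i} → k < suc n → suc i ≤ k → k ∸ suc i < n
    k∸1+i<n {suc k} {n} {i} (s≤s k<n) _ = ℕP.≤-<-trans (ℕP.m∸n≤m k i) k<n

compose-unfold : ∀ f w → w 0 ≡ +0 → compose f w ≐ cst (f 0) +ˢ w *ˢ compose (f ∘ suc) w
compose-unfold f w w₀≡0 k = begin
    compose f w k
  ≡⟨ sumBelow-suc k (λ n → f n * pow w n k) ⟩
    f 0 * one k + sumBelow k (λ n → f (suc n) * sumBelow (suc k) (λ i → w i * pow w n (k ∸ i)))
  ≡⟨ cong₂ _+_ (constant k) (sumBelow-cong k (λ n → sym (sumBelow-*ˡ (suc k) (f (suc n)) _))) ⟩
    cst (f 0) k + sumBelow k (λ n → sumBelow (suc k) (λ i → f (suc n) * (w i * pow w n (k ∸ i))))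
  ≡⟨ cong (λ z → cst (f 0) k + z) (sumBelow-comm k (suc k) _) ⟩
    cst (f 0) k + sumBelow (suc k) (λ i → sumBelow k (λ n → f (suc n) * (w i * pow w n (k ∸ i))))
  ≡⟨ cong (λ z → cst (f 0) k + z) (sumBelow-cong< (suc k) factor-wᵢ) ⟩
    cst (f 0) k + (w *ˢ compose (f ∘ suc) w) k
  ∎
  where
  open ≡-Reasoning
  constant : ∀ k → f 0 * one k ≡ cst (f 0) k
  constant zero    = ℤP.*-identityʳ (f 0)
  constant (suc k) = ℤP.*-zeroʳ (f 0)
  swap : ∀ a b c → a * (b * c) ≡ b * (a * c)
  swap = solve-∀
  -- the terms with n ≥ k - i + 1 vanish because w^n has no coefficient below n
  truncate : ∀ i → i < suc k → w i * sumBelow k (λ n → f (suc n) * pow w n (k ∸ i))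
                             ≡ w i * sumBelow (suc (k ∸ i)) (λ n → f (suc n) * pow w n (k ∸ i))
  truncate zero    _ rewrite w₀≡0 = refl
  truncate (suc i) (s≤s i<k) = cong (w (suc i) *_) (sumBelow-pad (suc (k ∸ suc i)) k (k∸i≤k i<k)
    (λ n 1+k∸i≤n _ → trans (cong (f (suc n) *_) (pow-vanishes w w₀≡0 n (k ∸ suc i) 1+k∸i≤n)) (ℤP.*-zeroʳ (f (suc n)))))
    where
    k∸i≤k : ∀ {k i} → suc i ≤ k → suc (k ∸ suc i) ≤ k
    k∸i≤k {suc k} {i} _ = s≤s (ℕP.m∸n≤m k i)
  factor-wᵢ : ∀ i → i < suc k → sumBelow k (λ n → f (suc n) * (w i * pow w n (k ∸ i)))
                              ≡ w i * sumBelow (suc (k ∸ i)) (λ n → f (suc n) * pow w n (k ∸ i))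
  factor-wᵢ i i<1+k =
    trans (sumBelow-cong k (λ n → swap (f (suc n)) (w i) _)) (trans (sumBelow-*ˡ k (w i) _) (truncate i i<1+k))

inv1-unfold : ∀ F → inv1 F ≐ 𝟏 +ˢ (-ˢ shiftX F) *ˢ inv1 F
inv1-unfold F k = trans (as-compose k) (trans (compose-unfold (λ _ → + 1) (-ˢ shiftX F) refl k)
  (cong (λ z → 𝟏 k + z) (sumBelow-cong (suc k) (λ i → cong ((-ˢ shiftX F) i *_) (sym (as-compose (k ∸ i)))))))
  where
  as-compose : inv1 F ≐ compose (λ _ → + 1) (-ˢ shiftX F)
  as-compose k = sumBelow-cong (suc k) (λ n → sym (ℤP.*-identityˡ _))

-- Tails of the continued fraction

-- T = 1 / (1 + s_m x T') is used in the form T = 1 + tailFactor m T' · T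
tailFactor : ℕ → Series → Series
tailFactor m F = -ˢ shiftX (scale (s m) F)

tailCF-unfold : ∀ m d → tailCF m (suc d) ≐ 𝟏 +ˢ tailFactor m (tailCF (suc m) d) *ˢ tailCF m (suc d)
tailCF-unfold m d = inv1-unfold (scale (s m) (tailCF (suc m) d))

tailCF-constant : ∀ m d → tailCF m d 0 ≡ + 1
tailCF-constant m zero    = refl
tailCF-constant m (suc d) = trans (tailCF-unfold m d 0) (cong (λ z → + 1 + z) (ℤP.*-zeroˡ (tailCF m (suc d) 0)))

tailCF-agree : ∀ {M} (U : ℕ → ℕ → Series) →
  (∀ m e → U m (suc e) ≈ 𝟏 +ˢ tailFactor m (U (suc m) e) *ˢ U m (suc e) [mod M ]) →
  (∀ m e → U m e 0 ≡ + 1 [mod M ]) →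
  ∀ k m d e → k ≤ d → k ≤ e → tailCF m d k ≡ U m e k [mod M ]
tailCF-agree {M} U U-unfold U-constant = <-rec Agree step
  where
  Agree : ℕ → Set
  Agree k = ∀ m d e → k ≤ d → k ≤ e → tailCF m d k ≡ U m e k [mod M ]
  step : ∀ k → (∀ {j} → j < k → Agree j) → Agree k
  step zero    ih m d e _ _ = ≡-mod-trans (≡⇒≡-mod (tailCF-constant m d)) (≡-mod-sym (U-constant m e))
  step (suc k) ih m (suc d) (suc e) 1+k≤1+d 1+k≤1+e =
    ≡-mod-trans (≡⇒≡-mod (tailCF-unfold m d (suc k)))
      (≡-mod-trans (+-cong-mod (≡⇒≡-mod {a = +0} refl)
                     (*ˢ-cong< (tailFactor m (tailCF (suc m) d)) (tailFactor m (U (suc m) e))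
                               (tailCF m (suc d)) (U m (suc e)) (suc k) refl refl factors tails))
                   (≡-mod-sym (coeff (U-unfold m e) (suc k))))
    where
    factors : ∀ i → i ≤ suc k → tailFactor m (tailCF (suc m) d) i ≡ tailFactor m (U (suc m) e) i [mod M ]
    factors zero    _         = ≡⇒≡-mod refl
    factors (suc i) (s≤s i≤k) = neg-cong-mod (*-cong-mod (≡⇒≡-mod {a = s m} refl)
      (ih (s≤s i≤k) (suc m) d e (ℕP.≤-trans i≤k (ℕP.≤-pred 1+k≤1+d)) (ℕP.≤-trans i≤k (ℕP.≤-pred 1+k≤1+e))))
    tails : ∀ j → j < suc k → tailCF m (suc d) j ≡ U m (suc e) j [mod M ]
    tails j j<1+k = ih j<1+k m (suc d) (suc e) (ℕP.≤-trans (ℕP.<⇒≤ j<1+k) 1+k≤1+d) (ℕP.≤-trans (ℕP.<⇒≤ j<1+k) 1+k≤1+e)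

truncCF-stable : ∀ k n → k ≤ n → truncCF n k ≡ truncCF k k
truncCF-stable k n k≤n = cong (s 0 *_) (≡-mod-0⇒≡
  (tailCF-agree tailCF (λ m e → ≐⇒≈ (tailCF-unfold m e)) (λ m e → ≡⇒≡-mod (tailCF-constant m e)) k 1 n k k≤n ℕP.≤-refl))

truncCF-converges : IsXAdicLimit truncCF (λ k → truncCF k k)
truncCF-converges k = k , truncCF-stable k

-- The period-doubling sequence as s = 1 - 2e

isEven-double : ∀ i → isEven (i ℕ.+ i) ≡ true
isEven-double zero    = refl
isEven-double (suc i) rewrite ℕP.+-suc i i = isEven-double i

isEven-double+1 : ∀ i → isEven (suc (i ℕ.+ i)) ≡ false
isEven-double+1 zero    = refl
isEven-double+1 (suc i) rewrite ℕP.+-suc i i = isEven-double+1 i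

half-double : ∀ i → ⌊ i ℕ.+ i /2⌋ ≡ i
half-double zero    = refl
half-double (suc i) rewrite ℕP.+-suc i i = cong suc (half-double i)

half-double+1 : ∀ i → ⌊ suc (i ℕ.+ i) /2⌋ ≡ i
half-double+1 zero    = refl
half-double+1 (suc i) rewrite ℕP.+-suc i i = cong suc (half-double+1 i)

eAux : ℕ → ℕ → ℤ
eAux zero    n = +0
eAux (suc f) n = if isEven n then +0 else + 1 - eAux f ⌊ n /2⌋

sAux≡1-2eAux : ∀ f n → sAux f n ≡ + 1 - (eAux f n + eAux f n)
sAux≡1-2eAux zero    n = refl
sAux≡1-2eAux (suc f) n with isEven n
... | true  = refl
... | false = trans (cong -_ (sAux≡1-2eAux f ⌊ n /2⌋)) (flip (eAux f ⌊ n /2⌋))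
  where
  flip : ∀ e → - (+ 1 - (e + e)) ≡ + 1 - ((+ 1 - e) + (+ 1 - e))
  flip = solve-∀

eAux-fuel : ∀ f f' n → n < f → n < f' → eAux f n ≡ eAux f' n
eAux-fuel (suc f) (suc f') zero    _         _          = refl
eAux-fuel (suc f) (suc f') (suc n) (s≤s n<f) (s≤s n<f') with isEven (suc n)
... | true  = refl
... | false = cong (λ z → + 1 - z) (eAux-fuel f f' ⌊ suc n /2⌋ (ℕP.<-≤-trans (ℕP.⌊n/2⌋<n n) n<f) (ℕP.<-≤-trans (ℕP.⌊n/2⌋<n n) n<f'))

e : ℕ → ℤ
e n = eAux (suc n) n

s≡1-2e : ∀ n → s n ≡ + 1 - (e n + e n)
s≡1-2e n = sAux≡1-2eAux (suc n) n

e-odd : ∀ i → e (suc (i ℕ.+ i)) ≡ + 1 - e i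
e-odd i rewrite isEven-double+1 i | half-double+1 i =
  cong (λ z → + 1 - z) (eAux-fuel (suc (i ℕ.+ i)) (suc i) i (s≤s (ℕP.m≤m+n i i)) ℕP.≤-refl)

e-even : ∀ i → e (suc (suc (i ℕ.+ i))) ≡ +0
e-even i rewrite isEven-double i = refl

-- Squaring modulo 2 and 4

atSquare : Series → Series
atSquare F k = if isEven k then F ⌊ k /2⌋ else +0

≈-mod-2⇒even-difference : ∀ {F G} → F ≈ G [mod + 2 ] → Σ Series λ H → F ≐ G +ˢ (H +ˢ H)
≈-mod-2⇒even-difference {F} {G} F≈G =
  (λ k → quotient (∣-difference (coeff F≈G k))) ,
  (λ k → let congruent (divides q eq) = coeff F≈G k in rearrange (F k) (G k) q eq)
  where
  rearrange : ∀ a b q → a - b ≡ q * + 2 → a ≡ b + (q + q)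
  rearrange a b q eq = trans (sym (cancel a b)) (cong (λ z → b + z) (trans eq (double q)))
    where
    cancel : ∀ a b → b + (a - b) ≡ a
    cancel = solve-∀
    double : ∀ q → q * + 2 ≡ q + q
    double = solve-∀

square-lift : ∀ {F G} → F ≈ G [mod + 2 ] → F *ˢ F ≈ G *ˢ G [mod + 4 ]
square-lift {F} {G} F≈G with ≈-mod-2⇒even-difference F≈G
... | H , F≐G+2H = ≈-trans (*ˢ-cong (≐⇒≈ F≐G+2H) (≐⇒≈ F≐G+2H))
  (solve 2 (λ G H → ((G :+ (H :+ H)) :* (G :+ (H :+ H))) := (G :* G)) ≈-refl G H)
  where open Mod4 using (solve; _:+_; _:*_; _:=_)

double-lift : ∀ {F G} → F ≈ G [mod + 2 ] → F +ˢ F ≈ G +ˢ G [mod + 4 ]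
double-lift {F} {G} F≈G with ≈-mod-2⇒even-difference F≈G
... | H , F≐G+2H = ≈-trans (+ˢ-cong (≐⇒≈ F≐G+2H) (≐⇒≈ F≐G+2H))
  (solve 2 (λ G H → ((G :+ (H :+ H)) :+ (G :+ (H :+ H))) := (G :+ G)) ≈-refl G H)
  where open Mod4 using (solve; _:+_; _:=_)

compose-X : ∀ {M} f → compose f X ≈ f [mod M ]
compose-X = affine-fixpoint-unique (λ f → compose f X) (λ f → f) (_∘ suc) (λ f → f 0) X refl
  (λ f → ≐⇒≈ (compose-unfold f X refl))
  (λ f → ≐⇒≈ (λ { zero → sym (ℤP.+-identityʳ (f 0))
                ; (suc k) → sym (trans (ℤP.+-identityˡ _) (sym (shiftX≐X*ˢ (f ∘ suc) (suc k)))) }))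

compose-X² : ∀ {M} f → compose f (X *ˢ X) ≈ atSquare f [mod M ]
compose-X² = affine-fixpoint-unique (λ f → compose f (X *ˢ X)) atSquare (_∘ suc) (λ f → f 0) (X *ˢ X) refl
  (λ f → ≐⇒≈ (compose-unfold f (X *ˢ X) refl)) (λ f → ≐⇒≈ (atSquare-unfold f))
  where
  X²-shift : ∀ F → X *ˢ X *ˢ F ≐ shiftX (shiftX F)
  X²-shift F k = trans (*ˢ-assoc X X F k)
    (trans (*ˢ-congᵖ {X} {X} (λ _ → refl) (≐-sym (shiftX≐X*ˢ F)) k) (sym (shiftX≐X*ˢ (shiftX F) k)))
  atSquare-unfold : ∀ f → atSquare f ≐ cst (f 0) +ˢ X *ˢ X *ˢ atSquare (f ∘ suc)
  atSquare-unfold f zero = sym (trans (cong (λ z → f 0 + z) (X²-shift (atSquare (f ∘ suc)) zero)) (ℤP.+-identityʳ (f 0)))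
  atSquare-unfold f (suc zero) = sym (trans (ℤP.+-identityˡ _) (X²-shift (atSquare (f ∘ suc)) 1))
  atSquare-unfold f (suc (suc k)) = sym (trans (ℤP.+-identityˡ _) (X²-shift (atSquare (f ∘ suc)) (suc (suc k))))

compose-frobenius : ∀ f w → w 0 ≡ +0 → compose f w *ˢ compose f w ≈ compose f (w *ˢ w) [mod + 2 ]
compose-frobenius f w w₀≡0 =
  affine-fixpoint-unique (λ f → compose f w *ˢ compose f w) (λ f → compose f (w *ˢ w)) (_∘ suc) (λ f → f 0)
    (w *ˢ w) w²₀≡0 square-unfold (λ f → ≐⇒≈ (compose-unfold f (w *ˢ w) w²₀≡0)) f
  where
  open Mod2 using (solve; _:+_; _:*_; _:=_)
  w²₀≡0 : (w *ˢ w) 0 ≡ +0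
  w²₀≡0 = *ˢ-constantˡ w w w₀≡0
  -- (c + w E)² ≡ c² + w² E² ≡ c + w² E² mod 2
  square-unfold : ∀ f → compose f w *ˢ compose f w ≈ cst (f 0) +ˢ w *ˢ w *ˢ (compose (f ∘ suc) w *ˢ compose (f ∘ suc) w) [mod + 2 ]
  square-unfold f = ≈-trans (*ˢ-cong (≐⇒≈ (compose-unfold f w w₀≡0)) (≐⇒≈ (compose-unfold f w w₀≡0)))
    (≈-trans (solve 3 (λ c w E → ((c :+ w :* E) :* (c :+ w :* E)) := (c :* c :+ w :* w :* (E :* E))) ≈-refl
                       (cst (f 0)) w (compose (f ∘ suc) w))
             (+ˢ-cong (≈-trans (≐⇒≈ (≐-sym (cst-* (f 0) (f 0)))) (cst-cong (square-mod-2 (f 0)))) ≈-refl))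

frobenius : ∀ F → F *ˢ F ≈ atSquare F [mod + 2 ]
frobenius F = ≈-trans (*ˢ-cong (≈-sym (compose-X F)) (≈-sym (compose-X F)))
                      (≈-trans (compose-frobenius F X refl) (compose-X² F))

-- Lacunary series Σᵢ x^(g i)

δ : ℕ → ℕ → ℤ
δ m n = if eqℕ m n then + 1 else + 0

δ-≡ : ∀ {m n} → m ≡ n → δ m n ≡ + 1
δ-≡ {m} refl with m ℕ.≟ m
... | yes _  = refl
... | no m≢m = ⊥-elim (m≢m refl)

δ-≢ : ∀ {m n} → m ≢ n → δ m n ≡ +0
δ-≢ {m} {n} m≢n with m ℕ.≟ n
... | yes m≡n = ⊥-elim (m≢n m≡n)
... | no _    = refl

δ-> : ∀ {x m} → m < x → δ x m ≡ +0
δ-> m<x = δ-≢ (λ x≡m → ℕP.<-irrefl (sym x≡m) m<x)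

δ-⇔ : ∀ {m n m' n'} → (m ≡ n → m' ≡ n') → (m' ≡ n' → m ≡ n) → δ m n ≡ δ m' n'
δ-⇔ {m} {n} to from with m ℕ.≟ n
... | yes m≡n = sym (δ-≡ (to m≡n))
... | no m≢n  = sym (δ-≢ (λ m'≡n' → m≢n (from m'≡n')))

double-injective : ∀ {x y} → x ℕ.+ x ≡ y ℕ.+ y → x ≡ y
double-injective {zero}  {zero}  _ = refl
double-injective {suc x} {suc y} eq rewrite ℕP.+-suc x x | ℕP.+-suc y y =
  cong suc (double-injective (ℕP.suc-injective (ℕP.suc-injective eq)))

double≢double+1 : ∀ x y → x ℕ.+ x ≢ suc (y ℕ.+ y)
double≢double+1 (suc x) zero    eq rewrite ℕP.+-suc x x with eq
... | ()
double≢double+1 (suc x) (suc y) eq rewrite ℕP.+-suc x x | ℕP.+-suc y y =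
  double≢double+1 x y (ℕP.suc-injective (ℕP.suc-injective eq))

δ-double : ∀ x y → δ (x ℕ.+ x) (y ℕ.+ y) ≡ δ x y
δ-double x y = δ-⇔ double-injective (cong (λ z → z ℕ.+ z))

δ-double-odd : ∀ x y → δ (x ℕ.+ x) (suc (y ℕ.+ y)) ≡ +0
δ-double-odd x y = δ-≢ (double≢double+1 x y)

parity : ∀ k → Σ ℕ (λ c → k ≡ c ℕ.+ c) ⊎ Σ ℕ (λ c → k ≡ suc (c ℕ.+ c))
parity zero = inj₁ (0 , refl)
parity (suc k) with parity k
... | inj₁ (c , k≡2c)   = inj₂ (c , cong suc k≡2c)
... | inj₂ (c , k≡2c+1) = inj₁ (suc c , trans (cong suc k≡2c+1) (cong suc (sym (ℕP.+-suc c c))))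

n<2^n : ∀ n → n < 2 ^ n
n<2^n zero    = s≤s z≤n
n<2^n (suc n) = ℕP.≤-trans (s≤s (n<2^n n))
  (subst (_≤ 2 ^ suc n) (ℕP.+-comm (2 ^ n) 1) (ℕP.+-monoʳ-≤ (2 ^ n) (ℕP.≤-trans (ℕP.m^n>0 2 n) (ℕP.m≤m+n (2 ^ n) 0))))

inflationary-≢ : ∀ (g : ℕ → ℕ) → (∀ i → i < g i) → ∀ {a i} → a ≤ i → g i ≢ a
inflationary-≢ g i<gi {a} {i} a≤i gi≡a = ℕP.<-irrefl (sym gi≡a) (ℕP.≤-<-trans a≤i (i<gi i))

2^suc : ∀ i → 2 ^ suc i ≡ 2 ^ i ℕ.+ 2 ^ i
2^suc i = cong (2 ^ i ℕ.+_) (ℕP.+-identityʳ (2 ^ i))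

sumBelow-δ-pad : ∀ (g : ℕ → ℕ) a t b → t ≤ b → (∀ i → t ≤ i → g i ≢ a) →
  sumBelow b (λ i → δ (g i) a) ≡ sumBelow t (λ i → δ (g i) a)
sumBelow-δ-pad g a t b t≤b g≢a = sumBelow-pad t b t≤b (λ i t≤i _ → δ-≢ (g≢a i t≤i))

sumBelow-δ-out : ∀ N c (H : ℕ → ℤ) → N ≤ c → sumBelow N (λ a → δ c a * H a) ≡ +0
sumBelow-δ-out N c H N≤c = sumBelow-≡0 N (λ a a<N →
  trans (cong (_* H a) (δ-> (ℕP.<-≤-trans a<N N≤c))) (ℤP.*-zeroˡ (H a)))

sumBelow-δ-in : ∀ N c (H : ℕ → ℤ) → c < N → sumBelow N (λ a → δ c a * H a) ≡ H c
sumBelow-δ-in (suc N) c H c<1+N with ℕP.m≤n⇒m<n∨m≡n (ℕP.≤-pred c<1+N)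
... | inj₁ c<N = trans (cong₂ _+_ (sumBelow-δ-in N c H c<N) (trans (cong (_* H N) (δ-≢ (ℕP.<⇒≢ c<N))) (ℤP.*-zeroˡ (H N))))
                       (ℤP.+-identityʳ (H c))
... | inj₂ refl = trans (cong₂ _+_ (sumBelow-δ-out c c H ℕP.≤-refl) (trans (cong (_* H c) (δ-≡ {c} refl)) (ℤP.*-identityˡ (H c))))
                        (ℤP.+-identityˡ (H c))

-- only i ≤ a can contribute to the coefficient of x^a when i < g i
lacunary : (ℕ → ℕ) → Series
lacunary g a = sumBelow (suc a) (λ i → δ (g i) a)

lacunary-sumBelow : ∀ g → (∀ i → i < g i) → ∀ a N → a < N → lacunary g a ≡ sumBelow N (λ i → δ (g i) a)
lacunary-sumBelow g i<gi a N a<N =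
  sym (sumBelow-δ-pad g a (suc a) N a<N (λ i a<i → inflationary-≢ g i<gi (ℕP.<⇒≤ a<i)))

P : Series
P = lacunary (2 ^_)

oddPow2 : ℕ → ℕ
oddPow2 k = 2 ^ (2 ℕ.* k ℕ.+ 1)

Q : Series
Q = lacunary oddPow2

oddPow2≡2^double+1 : ∀ k → oddPow2 k ≡ 2 ^ suc (k ℕ.+ k)
oddPow2≡2^double+1 k = cong (2 ^_) (trans (ℕP.+-comm (2 ℕ.* k) 1) (cong (λ z → suc (k ℕ.+ z)) (ℕP.+-identityʳ k)))

k<oddPow2 : ∀ k → k < oddPow2 k
k<oddPow2 k = subst (k <_) (sym (oddPow2≡2^double+1 k)) (ℕP.<-trans (s≤s (ℕP.m≤m+n k k)) (n<2^n (suc (k ℕ.+ k))))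

P-unfold : P ≐ X +ˢ atSquare P
P-unfold zero          = refl
P-unfold (suc zero)    = refl
P-unfold (suc (suc k)) = trans (sumBelow-suc (suc (suc k)) (λ i → δ (2 ^ i) (suc (suc k))))
  (trans (ℤP.+-identityˡ _) (trans (by-parity (parity k)) (sym (ℤP.+-identityˡ _))))
  where
  by-parity : Σ ℕ (λ c → k ≡ c ℕ.+ c) ⊎ Σ ℕ (λ c → k ≡ suc (c ℕ.+ c)) →
    sumBelow (suc (suc k)) (λ i → δ (2 ^ suc i) (suc (suc k))) ≡ atSquare P (suc (suc k))
  by-parity (inj₁ (c , refl)) rewrite isEven-double c | half-double c =
    trans (sumBelow-cong (suc (suc (c ℕ.+ c)))
             (λ i → trans (cong₂ δ (2^suc i) (cong suc (sym (ℕP.+-suc c c)))) (δ-double (2 ^ i) (suc c))))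
          (sym (lacunary-sumBelow (2 ^_) n<2^n (suc c) (suc (suc (c ℕ.+ c))) (s≤s (s≤s (ℕP.m≤m+n c c)))))
  by-parity (inj₂ (c , refl)) rewrite isEven-double+1 c =
    sumBelow-≡0 (suc (suc (suc (c ℕ.+ c)))) (λ i _ →
      trans (cong₂ δ (2^suc i) (cong (suc ∘ suc) (sym (ℕP.+-suc c c)))) (δ-double-odd (2 ^ i) (suc c)))

Q-odd : ∀ c → Q (suc (c ℕ.+ c)) ≡ +0
Q-odd c = sumBelow-≡0 (suc (suc (c ℕ.+ c))) (λ k _ →
  trans (cong (λ z → δ z (suc (c ℕ.+ c))) (trans (oddPow2≡2^double+1 k) (2^suc (k ℕ.+ k)))) (δ-double-odd (2 ^ (k ℕ.+ k)) c))

-- split P c by the parity of the exponent: 2^(2k) = c iff 2^(2k+1) = 2c, and 2^(2k+1) = c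
Q-unfold : Q +ˢ atSquare Q ≐ atSquare P
Q-unfold k with parity k
... | inj₂ (c , refl) rewrite isEven-double+1 c = cong (_+ +0) (Q-odd c)
... | inj₁ (c , refl) rewrite isEven-double c | half-double c = sym (begin
    P c
  ≡⟨ lacunary-sumBelow (2 ^_) n<2^n c (suc c ℕ.+ suc c) (ℕP.m≤m+n (suc c) (suc c)) ⟩
    sumBelow (suc c ℕ.+ suc c) (λ i → δ (2 ^ i) c)
  ≡⟨ sumBelow-parity (suc c) (λ i → δ (2 ^ i) c) ⟩
    sumBelow (suc c) (λ k → δ (2 ^ (k ℕ.+ k)) c) + sumBelow (suc c) (λ k → δ (2 ^ suc (k ℕ.+ k)) c)
  ≡⟨ cong₂ _+_ even-exponents (sumBelow-cong (suc c) (λ k → cong (λ z → δ z c) (sym (oddPow2≡2^double+1 k)))) ⟩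
    Q (c ℕ.+ c) + Q c
  ∎)
  where
  open ≡-Reasoning
  even-exponents : sumBelow (suc c) (λ k → δ (2 ^ (k ℕ.+ k)) c) ≡ Q (c ℕ.+ c)
  even-exponents = sym (trans
    (sumBelow-cong (suc (c ℕ.+ c)) (λ k →
      trans (cong (λ z → δ z (c ℕ.+ c)) (trans (oddPow2≡2^double+1 k) (2^suc (k ℕ.+ k)))) (δ-double _ c)))
    (sumBelow-δ-pad (λ k → 2 ^ (k ℕ.+ k)) c (suc c) (suc (c ℕ.+ c)) (s≤s (ℕP.m≤m+n c c))
      (λ i c<i → inflationary-≢ (2 ^_) n<2^n (ℕP.≤-trans (ℕP.<⇒≤ c<i) (ℕP.m≤m+n i i)))))

lacunary-*ˢ : ∀ g → (∀ i → i < g i) → ∀ F n →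
  (lacunary g *ˢ F) n ≡ sumBelow (suc n) (λ i → sumBelow (suc n) (λ a → δ (g i) a * F (n ∸ a)))
lacunary-*ˢ g i<gi F n = begin
    sumBelow (suc n) (λ a → lacunary g a * F (n ∸ a))
  ≡⟨ sumBelow-cong< (suc n) (λ a a<1+n → cong (_* F (n ∸ a)) (lacunary-sumBelow g i<gi a (suc n) a<1+n)) ⟩
    sumBelow (suc n) (λ a → sumBelow (suc n) (λ i → δ (g i) a) * F (n ∸ a))
  ≡⟨ sumBelow-cong (suc n) (λ a → sym (sumBelow-*ʳ (suc n) (F (n ∸ a)) (λ i → δ (g i) a))) ⟩
    sumBelow (suc n) (λ a → sumBelow (suc n) (λ i → δ (g i) a * F (n ∸ a)))
  ≡⟨ sumBelow-comm (suc n) (suc n) (λ a i → δ (g i) a * F (n ∸ a)) ⟩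
    sumBelow (suc n) (λ i → sumBelow (suc n) (λ a → δ (g i) a * F (n ∸ a)))
  ∎
  where open ≡-Reasoning

δ-shift : ∀ x y m → 1 ≤ x → x ≤ suc m → δ y (suc m ∸ x) ≡ δ (x ℕ.+ y ∸ 1) m
δ-shift (suc x) y m _ (s≤s x≤m) =
  δ-⇔ (λ y≡m∸x → trans (cong (x ℕ.+_) y≡m∸x) (ℕP.m+[n∸m]≡n x≤m)) (λ x+y≡m → trans (sym (ℕP.m+n∸m≡n x y)) (cong (_∸ x) x+y≡m))

δ-shift-out : ∀ x y m → suc (suc m) ≤ x → δ (x ℕ.+ y ∸ 1) m ≡ +0
δ-shift-out (suc x) y m (s≤s 1+m≤x) = δ-> (ℕP.≤-trans 1+m≤x (ℕP.m≤m+n x y))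

-- coefficient of x^(m+1) in x^g · P
monomial-*ˢ-P : ∀ m g → 1 ≤ g →
  sumBelow (suc (suc m)) (λ a → δ g a * P (suc m ∸ a)) ≡ sumBelow (suc (suc m)) (λ j → δ (g ℕ.+ 2 ^ j ∸ 1) m)
monomial-*ˢ-P m g 1≤g with g ℕ.<? suc (suc m)
... | yes g<m+2 = trans (sumBelow-δ-in (suc (suc m)) g (λ a → P (suc m ∸ a)) g<m+2)
  (trans (lacunary-sumBelow (2 ^_) n<2^n (suc m ∸ g) (suc (suc m)) (s≤s (ℕP.m∸n≤m (suc m) g)))
         (sumBelow-cong (suc (suc m)) (λ j → δ-shift g (2 ^ j) m 1≤g (ℕP.≤-pred g<m+2))))
... | no g≮m+2 = trans (sumBelow-δ-out (suc (suc m)) g (λ a → P (suc m ∸ a)) (ℕP.≮⇒≥ g≮m+2))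
  (sym (sumBelow-≡0 (suc (suc m)) (λ j _ → δ-shift-out g (2 ^ j) m (ℕP.≮⇒≥ g≮m+2))))

P²-coefficient : ∀ m → (P *ˢ P) (suc m) ≡ A m
P²-coefficient m = begin
    (P *ˢ P) (suc m)
  ≡⟨ lacunary-*ˢ (2 ^_) n<2^n P (suc m) ⟩
    sumBelow (suc (suc m)) (λ i → sumBelow (suc (suc m)) (λ a → δ (2 ^ i) a * P (suc m ∸ a)))
  ≡⟨ sumBelow-cong (suc (suc m)) (λ i → monomial-*ˢ-P m (2 ^ i) (ℕP.m^n>0 2 i)) ⟩
    sumBelow (suc (suc m)) (λ i → sumBelow (suc (suc m)) (λ j → δ (2 ^ i ℕ.+ 2 ^ j ∸ 1) m))
  ≡⟨ cong (λ N → sumBelow N (λ i → sumBelow N (λ j → δ (2 ^ i ℕ.+ 2 ^ j ∸ 1) m))) (ℕP.+-comm 2 m) ⟩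
    A m
  ∎
  where open ≡-Reasoning

δ-pred : ∀ x m → 1 ≤ x → δ x (suc m) ≡ δ (x ∸ 1) m
δ-pred (suc x) m _ = δ-⇔ ℕP.suc-injective (cong suc)

oddPow2-positive : ∀ k → 1 ≤ oddPow2 k
oddPow2-positive k = ℕP.m^n>0 2 (2 ℕ.* k ℕ.+ 1)

Q-coefficient : ∀ m → Q (suc m) ≡ countBelow (suc m) (λ k → eqℕ (oddPow2 k ∸ 1) m)
Q-coefficient m =
  trans (sumBelow-δ-pad oddPow2 (suc m) (suc m) (suc (suc m)) (ℕP.n≤1+n (suc m)) (λ i → inflationary-≢ oddPow2 k<oddPow2))
        (sumBelow-cong (suc m) (λ k → δ-pred (oddPow2 k) m (oddPow2-positive k)))

QP-coefficient : ∀ m → (Q *ˢ P) (suc m) ≡ sumBelow (suc m) (λ k → countBelow (suc m) (λ j → eqℕ ((oddPow2 k ∸ 1) ℕ.+ 2 ^ j) m))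
QP-coefficient m = begin
    (Q *ˢ P) (suc m)
  ≡⟨ lacunary-*ˢ oddPow2 k<oddPow2 P (suc m) ⟩
    sumBelow (suc (suc m)) (λ k → sumBelow (suc (suc m)) (λ a → δ (oddPow2 k) a * P (suc m ∸ a)))
  ≡⟨ sumBelow-cong (suc (suc m)) (λ k → trans (monomial-*ˢ-P m (oddPow2 k) (oddPow2-positive k)) (drop-large-j k)) ⟩
    sumBelow (suc (suc m)) (λ k → sumBelow (suc m) (λ j → δ ((oddPow2 k ∸ 1) ℕ.+ 2 ^ j) m))
  ≡⟨ sumBelow-pad (suc m) (suc (suc m)) (ℕP.n≤1+n (suc m)) (λ k 1+m≤k _ → sumBelow-≡0 (suc m) (λ j _ →
       δ-> (ℕP.≤-trans (oddPow2∸1-large 1+m≤k) (ℕP.m≤m+n (oddPow2 k ∸ 1) (2 ^ j))))) ⟩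
    sumBelow (suc m) (λ k → sumBelow (suc m) (λ j → δ ((oddPow2 k ∸ 1) ℕ.+ 2 ^ j) m))
  ∎
  where
  open ≡-Reasoning
  drop-large-j : ∀ k → sumBelow (suc (suc m)) (λ j → δ (oddPow2 k ℕ.+ 2 ^ j ∸ 1) m)
                     ≡ sumBelow (suc m) (λ j → δ ((oddPow2 k ∸ 1) ℕ.+ 2 ^ j) m)
  drop-large-j k = trans (sumBelow-cong (suc (suc m)) (λ j → cong (λ z → δ z m) (ℕP.+-∸-comm (2 ^ j) (oddPow2-positive k))))
    (sumBelow-pad (suc m) (suc (suc m)) (ℕP.n≤1+n (suc m)) (λ j 1+m≤j _ →
       δ-> (ℕP.≤-trans (ℕP.<-trans 1+m≤j (n<2^n j)) (ℕP.m≤n+m (2 ^ j) (oddPow2 k ∸ 1)))))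
  oddPow2∸1-large : ∀ {k} → suc m ≤ k → suc m ≤ oddPow2 k ∸ 1
  oddPow2∸1-large {k} 1+m≤k = ℕP.∸-monoˡ-≤ 1 (ℕP.≤-trans (s≤s 1+m≤k) (k<oddPow2 k))

Q+QP-coefficient : ∀ m → Q (suc m) + (Q *ˢ P) (suc m) ≡ B m
Q+QP-coefficient m = cong₂ _+_ (Q-coefficient m) (QP-coefficient m)

P+P²≈X : P +ˢ P *ˢ P ≈ X [mod + 2 ]
P+P²≈X = begin
    P +ˢ P *ˢ P         ≈⟨ +ˢ-congˡ P (frobenius P) ⟩
    P +ˢ atSquare P     ≈⟨ +ˢ-congʳ (atSquare P) (≐⇒≈ P-unfold) ⟩
    X +ˢ atSquare P +ˢ atSquare P ≈⟨ solve 2 (λ X S → (X :+ S :+ S) := X) ≈-refl X (atSquare P) ⟩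
    X                   ∎
  where
  open ≈-Reasoning (+ 2)
  open Mod2 using (solve; _:+_; _:=_)

Q+Q²≈P² : Q +ˢ Q *ˢ Q ≈ P *ˢ P [mod + 2 ]
Q+Q²≈P² = ≈-trans (+ˢ-congˡ Q (frobenius Q)) (≈-trans (≐⇒≈ Q-unfold) (≈-sym (frobenius P)))

X-P²≈P : X -ˢ P *ˢ P ≈ P [mod + 2 ]
X-P²≈P = begin
    X -ˢ P *ˢ P               ≈⟨ solve 2 (λ P X → (X :- P :* P) := (X :+ (P :+ P :* P) :+ P)) ≈-refl P X ⟩
    X +ˢ (P +ˢ P *ˢ P) +ˢ P   ≈⟨ +ˢ-congʳ P (+ˢ-congˡ X P+P²≈X) ⟩
    X +ˢ X +ˢ P               ≈⟨ solve 2 (λ P X → (X :+ X :+ P) := P) ≈-refl P X ⟩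
    P                         ∎
  where
  open ≈-Reasoning (+ 2)
  open Mod2 using (solve; _:+_; _:-_; _:*_; _:=_)

-- The tails of the continued fraction modulo 4

C : Series
C k = 𝟏 k - (P *ˢ P) (suc k)

X*ˢC : X *ˢ C ≐ X -ˢ P *ˢ P
X*ˢC zero    = refl
X*ˢC (suc k) = trans (sym (shiftX≐X*ˢ C (suc k))) (cong (_- (P *ˢ P) (suc k)) (𝟏≡X∘suc k))
  where
  𝟏≡X∘suc : ∀ k → 𝟏 k ≡ X (suc k)
  𝟏≡X∘suc zero    = refl
  𝟏≡X∘suc (suc k) = refl

C+XC²≈1 : C +ˢ X *ˢ C *ˢ C ≈ 𝟏 [mod + 4 ]
C+XC²≈1 = X-cancel (begin
    X *ˢ (C +ˢ X *ˢ C *ˢ C)             ≈⟨ solve 2 (λ X C → (X :* (C :+ X :* C :* C)) := (X :* C :+ (X :* C) :* (X :* C))) ≈-refl X C ⟩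
    X *ˢ C +ˢ (X *ˢ C) *ˢ (X *ˢ C)      ≈⟨ +ˢ-cong (≐⇒≈ X*ˢC) (*ˢ-cong (≐⇒≈ X*ˢC) (≐⇒≈ X*ˢC)) ⟩
    X -ˢ P *ˢ P +ˢ (X -ˢ P *ˢ P) *ˢ (X -ˢ P *ˢ P) ≈⟨ +ˢ-congˡ (X -ˢ P *ˢ P) (square-lift X-P²≈P) ⟩
    X -ˢ P *ˢ P +ˢ P *ˢ P               ≈⟨ solve 2 (λ X P → (X :- P :* P :+ P :* P) := (X :* con (+ 1))) ≈-refl X P ⟩
    X *ˢ 𝟏                              ∎)
  where
  open ≈-Reasoning (+ 4)
  open Mod4 using (solve; _:+_; _:-_; _:*_; _:=_; con)

w : Series
w = X *ˢ C *ˢ C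

w₀≡0 : w 0 ≡ +0
w₀≡0 = *ˢ-constantˡ (X *ˢ C) C (*ˢ-constantˡ X C refl)

E : ℕ → Series
E m = compose (λ n → e (m ℕ.+ n)) w

E-unfold : ∀ m → E m ≐ cst (e m) +ˢ w *ˢ E (suc m)
E-unfold m k = trans (compose-unfold (λ n → e (m ℕ.+ n)) w w₀≡0 k)
  (cong₂ _+_ (cong (λ n → cst (e n) k) (ℕP.+-identityʳ m))
             (*ˢ-congᵖ {w} {w} (λ _ → refl) (compose-cong w (λ n → cong e (ℕP.+-suc m n))) k))

-- G m is the m-th tail of the continued fraction modulo 4
G : ℕ → Series
G m = C *ˢ (𝟏 +ˢ (w *ˢ E m +ˢ w *ˢ E m))

tailFactor-via-e : ∀ m F → tailFactor m F ≐ -ˢ (X *ˢ ((𝟏 -ˢ (cst (e m) +ˢ cst (e m))) *ˢ F))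
tailFactor-via-e m F k = cong -_ (trans (shiftX≐X*ˢ (scale (s m) F) k)
  (*ˢ-congᵖ {X} {X} (λ _ → refl) (λ j → trans (sym (cst-*ˢ (s m) F j)) (*ˢ-congᵖ {G = F} {G' = F} s≐1-2e (λ _ → refl) j)) k))
  where
  s≐1-2e : cst (s m) ≐ 𝟏 -ˢ (cst (e m) +ˢ cst (e m))
  s≐1-2e zero    = s≡1-2e m
  s≐1-2e (suc j) = refl

-- Modulo 4, the defect of C·T from the tail recursion is a multiple of C + X C² - 1.
tail-recursion-identity : ∀ C X ε a →
  let w = X *ˢ C *ˢ C ; T = 𝟏 +ˢ (w *ˢ (ε +ˢ a) +ˢ w *ˢ (ε +ˢ a)) in
  C *ˢ T ≈ 𝟏 +ˢ (-ˢ (X *ˢ ((𝟏 -ˢ (ε +ˢ ε)) *ˢ (C *ˢ (𝟏 +ˢ (a +ˢ a)))))) *ˢ (C *ˢ T) +ˢ (C +ˢ X *ˢ C *ˢ C -ˢ 𝟏) *ˢ T [mod + 4 ]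
tail-recursion-identity = solve 4 (λ C X ε a →
  let w = X :* C :* C ; T = con (+ 1) :+ (w :* (ε :+ a) :+ w :* (ε :+ a)) in
  (C :* T) := (con (+ 1) :+ (:- (X :* ((con (+ 1) :- (ε :+ ε)) :* (C :* (con (+ 1) :+ (a :+ a)))))) :* (C :* T)
               :+ (C :+ X :* C :* C :- con (+ 1)) :* T)) ≈-refl
  where open Mod4 using (solve; _:+_; _:-_; _:*_; :-_; _:=_; con)

G-unfold : ∀ m → G m ≈ 𝟏 +ˢ tailFactor m (G (suc m)) *ˢ G m [mod + 4 ]
G-unfold m = begin
    G m
  ≈⟨ G≈CT ⟩
    C *ˢ T
  ≈⟨ tail-recursion-identity C X ε a ⟩
    𝟏 +ˢ N *ˢ (C *ˢ T) +ˢ (C +ˢ X *ˢ C *ˢ C -ˢ 𝟏) *ˢ T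
  ≈⟨ +ˢ-congˡ (𝟏 +ˢ N *ˢ (C *ˢ T)) (*ˢ-congʳ T (+ˢ-congʳ (-ˢ 𝟏) C+XC²≈1)) ⟩
    𝟏 +ˢ N *ˢ (C *ˢ T) +ˢ (𝟏 -ˢ 𝟏) *ˢ T
  ≈⟨ solve 2 (λ R T → (R :+ (con (+ 1) :- con (+ 1)) :* T) := R) ≈-refl (𝟏 +ˢ N *ˢ (C *ˢ T)) T ⟩
    𝟏 +ˢ N *ˢ (C *ˢ T)
  ≈⟨ +ˢ-congˡ 𝟏 (*ˢ-cong (≐⇒≈ (≐-sym (tailFactor-via-e m (G (suc m))))) (≈-sym G≈CT)) ⟩
    𝟏 +ˢ tailFactor m (G (suc m)) *ˢ G m
  ∎
  where
  open ≈-Reasoning (+ 4)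
  open Mod4 using (solve; _:+_; _:-_; _:*_; _:=_; con)
  ε = cst (e m)
  a = w *ˢ E (suc m)
  T = 𝟏 +ˢ (w *ˢ (ε +ˢ a) +ˢ w *ˢ (ε +ˢ a))
  N = -ˢ (X *ˢ ((𝟏 -ˢ (ε +ˢ ε)) *ˢ (C *ˢ (𝟏 +ˢ (a +ˢ a)))))
  wE≈w[ε+a] : w *ˢ E m ≈ w *ˢ (ε +ˢ a) [mod + 4 ]
  wE≈w[ε+a] = ≐⇒≈ (*ˢ-congᵖ {w} {w} (λ _ → refl) (E-unfold m))
  G≈CT : G m ≈ C *ˢ T [mod + 4 ]
  G≈CT = *ˢ-congˡ C (+ˢ-congˡ 𝟏 (+ˢ-cong wE≈w[ε+a] wE≈w[ε+a]))

truncCF≡G₁ : ∀ k → truncCF k k ≡ G 1 k [mod + 4 ]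
truncCF≡G₁ k = ≡-mod-trans (≡⇒≡-mod (ℤP.*-identityˡ (tailCF 1 k k)))
  (tailCF-agree (λ m _ → G m) (λ m _ → G-unfold m) (λ m _ → G-constant m) k 1 k k ℕP.≤-refl ℕP.≤-refl)
  where
  G-constant : ∀ m → G m 0 ≡ + 1 [mod + 4 ]
  G-constant m = ≡-mod-trans (coeff (G-unfold m) 0)
    (≡⇒≡-mod (cong (λ z → + 1 + z) (trans (ℤP.+-identityˡ _) (ℤP.*-zeroˡ (G m 0)))))

-- The generating function of e modulo 2

compose-even-odd : ∀ f v → v 0 ≡ +0 →
  compose f v ≈ compose (λ i → f (i ℕ.+ i)) (v *ˢ v) +ˢ v *ˢ compose (λ i → f (suc (i ℕ.+ i))) (v *ˢ v) [mod + 2 ]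
compose-even-odd f v v₀≡0 = affine-fixpoint-unique (λ f → compose f v) split (_∘ suc) (λ f → f 0) v v₀≡0
  (λ f → ≐⇒≈ (compose-unfold f v v₀≡0)) split-unfold f
  where
  open Mod2 using (solve; _:+_; _:*_; _:=_)
  v²₀≡0 : (v *ˢ v) 0 ≡ +0
  v²₀≡0 = *ˢ-constantˡ v v v₀≡0
  even odd : (ℕ → ℤ) → Series
  even f = compose (λ i → f (i ℕ.+ i)) (v *ˢ v)
  odd  f = compose (λ i → f (suc (i ℕ.+ i))) (v *ˢ v)
  split : (ℕ → ℤ) → Series
  split f = even f +ˢ v *ˢ odd f
  split-unfold : ∀ f → split f ≈ cst (f 0) +ˢ v *ˢ split (f ∘ suc) [mod + 2 ]
  split-unfold f = ≈-trans (+ˢ-congʳ (v *ˢ odd f) (≐⇒≈ (compose-unfold (λ i → f (i ℕ.+ i)) (v *ˢ v) v²₀≡0)))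
    (≈-trans (solve 4 (λ c v O Ev → ((c :+ (v :* v) :* Ev) :+ v :* O) := (c :+ v :* (O :+ v :* Ev))) ≈-refl
                      (cst (f 0)) v (odd f) (compose (λ i → f (suc i ℕ.+ suc i)) (v *ˢ v)))
             (+ˢ-congˡ (cst (f 0)) (*ˢ-congˡ v (+ˢ-congˡ (odd f)
               (*ˢ-congˡ v (≐⇒≈ (compose-cong (v *ˢ v) (λ i → cong (f ∘ suc) (ℕP.+-suc i i)))))))))

compose-one-minus : ∀ v (f : ℕ → ℤ) → compose (λ i → + 1 - f i) v ≐ compose (λ _ → + 1) v -ˢ compose f v
compose-one-minus v f k = trans (sumBelow-cong (suc k) (λ n → ℤP.*-distribʳ-+ (pow v n k) (+ 1) (- f n)))
  (trans (sumBelow-+ (suc k) _ _) (cong (λ z → compose (λ _ → + 1) v k + z)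
    (trans (sumBelow-cong (suc k) (λ n → sym (ℤP.neg-distribˡ-* (f n) (pow v n k)))) (sumBelow-neg (suc k) _))))

compose-0 : ∀ v → compose (λ _ → +0) v ≐ 𝟎
compose-0 v zero    = sumBelow-≡0 1 (λ n _ → ℤP.*-zeroˡ (pow v n 0))
compose-0 v (suc k) = sumBelow-≡0 (suc (suc k)) (λ n _ → ℤP.*-zeroˡ (pow v n (suc k)))

R : Series
R = compose (λ _ → + 1) (w *ˢ w)

R-unfold : R ≐ 𝟏 +ˢ w *ˢ w *ˢ R
R-unfold = compose-unfold (λ _ → + 1) (w *ˢ w) (*ˢ-constantˡ w w w₀≡0)

E₀≐wE₁ : E 0 ≐ w *ˢ E 1
E₀≐wE₁ k = trans (E-unfold 0 k) (e₀-vanishes k)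
  where
  e₀-vanishes : ∀ k → cst (e 0) k + (w *ˢ E 1) k ≡ (w *ˢ E 1) k
  e₀-vanishes zero    = ℤP.+-identityˡ _
  e₀-vanishes (suc k) = ℤP.+-identityˡ _

-- e(2i+1) = 1 - e(i) and e(2i+2) = 0
E₁≈R+E₀² : E 1 ≈ R +ˢ E 0 *ˢ E 0 [mod + 2 ]
E₁≈R+E₀² = begin
    E 1
  ≈⟨ compose-even-odd (e ∘ suc) w w₀≡0 ⟩
    compose (λ i → e (suc (i ℕ.+ i))) (w *ˢ w) +ˢ w *ˢ compose (λ i → e (suc (suc (i ℕ.+ i)))) (w *ˢ w)
  ≈⟨ +ˢ-cong (≐⇒≈ (≐-trans (compose-cong (w *ˢ w) e-odd) (compose-one-minus (w *ˢ w) e)))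
             (*ˢ-congˡ w (≐⇒≈ (≐-trans (compose-cong (w *ˢ w) e-even) (compose-0 (w *ˢ w))))) ⟩
    R -ˢ compose e (w *ˢ w) +ˢ w *ˢ 𝟎
  ≈⟨ solve 3 (λ R Z w → (R :- Z :+ w :* con +0) := (R :+ Z)) ≈-refl R (compose e (w *ˢ w)) w ⟩
    R +ˢ compose e (w *ˢ w)
  ≈⟨ +ˢ-congˡ R (≈-sym (compose-frobenius e w w₀≡0)) ⟩
    R +ˢ E 0 *ˢ E 0
  ∎
  where
  open ≈-Reasoning (+ 2)
  open Mod2 using (solve; _:+_; _:-_; _:*_; _:=_; con)

XC≈P : X *ˢ C ≈ P [mod + 2 ]
XC≈P = ≈-trans (≐⇒≈ X*ˢC) X-P²≈P

X[1+w]≈P : X *ˢ (𝟏 +ˢ w) ≈ P [mod + 2 ]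
X[1+w]≈P = begin
    X *ˢ (𝟏 +ˢ w)                 ≈⟨ solve 2 (λ X C → (X :* (con (+ 1) :+ X :* C :* C)) := (X :+ (X :* C) :* (X :* C))) ≈-refl X C ⟩
    X +ˢ (X *ˢ C) *ˢ (X *ˢ C)     ≈⟨ +ˢ-congˡ X (*ˢ-cong XC≈P XC≈P) ⟩
    X +ˢ P *ˢ P                   ≈⟨ +ˢ-congʳ (P *ˢ P) (≈-sym P+P²≈X) ⟩
    P +ˢ P *ˢ P +ˢ P *ˢ P         ≈⟨ solve 1 (λ P → (P :+ P :* P :+ P :* P) := P) ≈-refl P ⟩
    P                             ∎
  where
  open ≈-Reasoning (+ 2)
  open Mod2 using (solve; _:+_; _:*_; _:=_; con)

-- R = 1/(1 + w)² and X (1 + w) ≡ P modulo 2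
P²R≈X² : P *ˢ P *ˢ R ≈ X *ˢ X [mod + 2 ]
P²R≈X² = begin
    P *ˢ P *ˢ R                                   ≈⟨ *ˢ-congʳ R (*ˢ-cong (≈-sym X[1+w]≈P) (≈-sym X[1+w]≈P)) ⟩
    X *ˢ (𝟏 +ˢ w) *ˢ (X *ˢ (𝟏 +ˢ w)) *ˢ R         ≈⟨ solve 3 (λ X w R → (X :* (con (+ 1) :+ w) :* (X :* (con (+ 1) :+ w)) :* R)
                                                                      := (X :* X :* (R :+ w :* w :* R))) ≈-refl X w R ⟩
    X *ˢ X *ˢ (R +ˢ w *ˢ w *ˢ R)                  ≈⟨ *ˢ-congˡ (X *ˢ X) (+ˢ-congʳ (w *ˢ w *ˢ R) (≐⇒≈ R-unfold)) ⟩
    X *ˢ X *ˢ (𝟏 +ˢ w *ˢ w *ˢ R +ˢ w *ˢ w *ˢ R)   ≈⟨ solve 3 (λ X w R → (X :* X :* (con (+ 1) :+ w :* w :* R :+ w :* w :* R))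
                                                                      := (X :* X)) ≈-refl X w R ⟩
    X *ˢ X                                        ∎
  where
  open ≈-Reasoning (+ 2)
  open Mod2 using (solve; _:+_; _:*_; _:=_; con)

P⁺ Q⁺ : Series
P⁺ k = P (suc k)
Q⁺ k = Q (suc k)

P≐XP⁺ : P ≐ X *ˢ P⁺
P≐XP⁺ k = trans (P≐shiftX k) (shiftX≐X*ˢ P⁺ k)
  where
  P≐shiftX : ∀ k → P k ≡ shiftX P⁺ k
  P≐shiftX zero    = refl
  P≐shiftX (suc k) = refl

Q≐XQ⁺ : Q ≐ X *ˢ Q⁺
Q≐XQ⁺ k = trans (Q≐shiftX k) (shiftX≐X*ˢ Q⁺ k)
  where
  Q≐shiftX : ∀ k → Q k ≡ shiftX Q⁺ k
  Q≐shiftX zero    = refl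
  Q≐shiftX (suc k) = refl

E₀-quadratic : E 0 ≈ X +ˢ X *ˢ (P⁺ *ˢ P⁺ *ˢ (E 0 *ˢ E 0)) [mod + 2 ]
E₀-quadratic = X-cancel (begin
    X *ˢ E 0                                      ≈⟨ *ˢ-congˡ X (≐⇒≈ E₀≐wE₁) ⟩
    X *ˢ (w *ˢ E 1)                               ≈⟨ *ˢ-congˡ X (*ˢ-congˡ w E₁≈R+E₀²) ⟩
    X *ˢ (w *ˢ (R +ˢ E₀²))                        ≈⟨ solve 4 (λ X C R S → (X :* (X :* C :* C :* (R :+ S)))
                                                            := ((X :* C) :* (X :* C) :* R :+ (X :* C) :* (X :* C) :* S)) ≈-refl X C R E₀² ⟩
    (X *ˢ C) *ˢ (X *ˢ C) *ˢ R +ˢ (X *ˢ C) *ˢ (X *ˢ C) *ˢ E₀²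
                                                  ≈⟨ +ˢ-cong (*ˢ-congʳ R P²≈) (*ˢ-congʳ E₀² P²≈) ⟩
    P *ˢ P *ˢ R +ˢ P *ˢ P *ˢ E₀²                  ≈⟨ +ˢ-cong P²R≈X² (*ˢ-congʳ E₀² (*ˢ-cong (≐⇒≈ P≐XP⁺) (≐⇒≈ P≐XP⁺))) ⟩
    X *ˢ X +ˢ X *ˢ P⁺ *ˢ (X *ˢ P⁺) *ˢ E₀²         ≈⟨ solve 3 (λ X p S → (X :* X :+ X :* p :* (X :* p) :* S) := (X :* (X :+ X :* (p :* p :* S))))
                                                            ≈-refl X P⁺ E₀² ⟩
    X *ˢ (X +ˢ X *ˢ (P⁺ *ˢ P⁺ *ˢ E₀²))            ∎)
  where
  open ≈-Reasoning (+ 2)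
  open Mod2 using (solve; _:+_; _:*_; _:=_)
  E₀² = E 0 *ˢ E 0
  P²≈ : (X *ˢ C) *ˢ (X *ˢ C) ≈ P *ˢ P [mod + 2 ]
  P²≈ = *ˢ-cong XC≈P XC≈P

P⁺E₀-quadratic : P⁺ *ˢ E 0 ≈ P +ˢ X *ˢ (P⁺ *ˢ (P⁺ *ˢ E 0) *ˢ (P⁺ *ˢ E 0)) [mod + 2 ]
P⁺E₀-quadratic = begin
    P⁺ *ˢ E 0                                           ≈⟨ *ˢ-congˡ P⁺ E₀-quadratic ⟩
    P⁺ *ˢ (X +ˢ X *ˢ (P⁺ *ˢ P⁺ *ˢ (E 0 *ˢ E 0)))        ≈⟨ solve 3 (λ X p E → (p :* (X :+ X :* (p :* p :* (E :* E))))
                                                                  := (X :* p :+ X :* (p :* (p :* E) :* (p :* E)))) ≈-refl X P⁺ (E 0) ⟩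
    X *ˢ P⁺ +ˢ X *ˢ (P⁺ *ˢ (P⁺ *ˢ E 0) *ˢ (P⁺ *ˢ E 0))  ≈⟨ +ˢ-congʳ (X *ˢ (P⁺ *ˢ (P⁺ *ˢ E 0) *ˢ (P⁺ *ˢ E 0))) (≐⇒≈ (≐-sym P≐XP⁺)) ⟩
    P +ˢ X *ˢ (P⁺ *ˢ (P⁺ *ˢ E 0) *ˢ (P⁺ *ˢ E 0))        ∎
  where
  open ≈-Reasoning (+ 2)
  open Mod2 using (solve; _:+_; _:*_; _:=_)

P[1+P]≈X : P *ˢ (𝟏 +ˢ P) ≈ X [mod + 2 ]
P[1+P]≈X = ≈-trans (solve 1 (λ P → (P :* (con (+ 1) :+ P)) := (P :+ P :* P)) ≈-refl P) P+P²≈X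
  where open Mod2 using (solve; _:+_; _:*_; _:=_; con)

P[Q[1+P]]²≈XQ[1+P]+X²P : P *ˢ (Q *ˢ (𝟏 +ˢ P)) *ˢ (Q *ˢ (𝟏 +ˢ P)) ≈ X *ˢ (Q *ˢ (𝟏 +ˢ P)) +ˢ X *ˢ X *ˢ P [mod + 2 ]
P[Q[1+P]]²≈XQ[1+P]+X²P = begin
    P *ˢ (Q *ˢ u) *ˢ (Q *ˢ u)              ≈⟨ solve 3 (λ P Q u → (P :* (Q :* u) :* (Q :* u)) := (P :* u :* u :* (Q :* Q))) ≈-refl P Q u ⟩
    P *ˢ u *ˢ u *ˢ (Q *ˢ Q)                ≈⟨ *ˢ-congʳ (Q *ˢ Q) (*ˢ-congʳ u P[1+P]≈X) ⟩
    X *ˢ u *ˢ (Q *ˢ Q)                     ≈⟨ solve 3 (λ X u Q → (X :* u :* (Q :* Q)) := (X :* u :* (Q :+ Q :* Q) :+ X :* Q :* u)) ≈-refl X u Q ⟩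
    X *ˢ u *ˢ (Q +ˢ Q *ˢ Q) +ˢ X *ˢ Q *ˢ u ≈⟨ +ˢ-congʳ (X *ˢ Q *ˢ u) (*ˢ-congˡ (X *ˢ u) Q+Q²≈P²) ⟩
    X *ˢ u *ˢ (P *ˢ P) +ˢ X *ˢ Q *ˢ u      ≈⟨ +ˢ-congʳ (X *ˢ Q *ˢ u) (solve 3 (λ X u P → (X :* u :* (P :* P)) := (X :* P :* (P :* u))) ≈-refl X u P) ⟩
    X *ˢ P *ˢ (P *ˢ u) +ˢ X *ˢ Q *ˢ u      ≈⟨ +ˢ-congʳ (X *ˢ Q *ˢ u) (*ˢ-congˡ (X *ˢ P) P[1+P]≈X) ⟩
    X *ˢ P *ˢ X +ˢ X *ˢ Q *ˢ u             ≈⟨ solve 4 (λ X P Q u → (X :* P :* X :+ X :* Q :* u) := (X :* (Q :* u) :+ X :* X :* P)) ≈-refl X P Q u ⟩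
    X *ˢ (Q *ˢ u) +ˢ X *ˢ X *ˢ P           ∎
  where
  open ≈-Reasoning (+ 2)
  open Mod2 using (solve; _:+_; _:*_; _:=_)
  u = 𝟏 +ˢ P

Q[1+P]≐XQ⁺[1+P] : Q *ˢ (𝟏 +ˢ P) ≐ X *ˢ (Q⁺ *ˢ (𝟏 +ˢ P))
Q[1+P]≐XQ⁺[1+P] = ≐-trans (*ˢ-congᵖ {G = 𝟏 +ˢ P} {G' = 𝟏 +ˢ P} Q≐XQ⁺ (λ _ → refl)) (*ˢ-assoc X Q⁺ (𝟏 +ˢ P))

Q⁺[1+P]-quadratic : Q⁺ *ˢ (𝟏 +ˢ P) ≈ P +ˢ X *ˢ (P⁺ *ˢ (Q⁺ *ˢ (𝟏 +ˢ P)) *ˢ (Q⁺ *ˢ (𝟏 +ˢ P))) [mod + 2 ]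
Q⁺[1+P]-quadratic = X-cancel (X-cancel (begin
    X *ˢ (X *ˢ Z)                               ≈⟨ *ˢ-congˡ X (≐⇒≈ (≐-sym Q[1+P]≐XQ⁺[1+P])) ⟩
    X *ˢ W                                      ≈⟨ solve 3 (λ X W P → (X :* W) := (X :* W :+ X :* X :* P :+ X :* X :* P)) ≈-refl X W P ⟩
    X *ˢ W +ˢ X *ˢ X *ˢ P +ˢ X *ˢ X *ˢ P        ≈⟨ +ˢ-congʳ (X *ˢ X *ˢ P) (≈-sym P[Q[1+P]]²≈XQ[1+P]+X²P) ⟩
    P *ˢ W *ˢ W +ˢ X *ˢ X *ˢ P                  ≈⟨ +ˢ-congʳ (X *ˢ X *ˢ P) (*ˢ-cong (*ˢ-cong (≐⇒≈ P≐XP⁺) (≐⇒≈ Q[1+P]≐XQ⁺[1+P])) (≐⇒≈ Q[1+P]≐XQ⁺[1+P])) ⟩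
    X *ˢ P⁺ *ˢ (X *ˢ Z) *ˢ (X *ˢ Z) +ˢ X *ˢ X *ˢ P
                                                ≈⟨ solve 4 (λ X p Z P → (X :* p :* (X :* Z) :* (X :* Z) :+ X :* X :* P)
                                                                     := (X :* (X :* (P :+ X :* (p :* Z :* Z))))) ≈-refl X P⁺ Z P ⟩
    X *ˢ (X *ˢ (P +ˢ X *ˢ (P⁺ *ˢ Z *ˢ Z)))      ∎))
  where
  open ≈-Reasoning (+ 2)
  open Mod2 using (solve; _:+_; _:*_; _:=_)
  Z = Q⁺ *ˢ (𝟏 +ˢ P)
  W = Q *ˢ (𝟏 +ˢ P)

XCE₀≈Q[1+P] : X *ˢ C *ˢ E 0 ≈ Q *ˢ (𝟏 +ˢ P) [mod + 2 ]
XCE₀≈Q[1+P] = begin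
    X *ˢ C *ˢ E 0              ≈⟨ *ˢ-congʳ (E 0) XC≈P ⟩
    P *ˢ E 0                   ≈⟨ ≐⇒≈ (≐-trans (*ˢ-congᵖ {G = E 0} {G' = E 0} P≐XP⁺ (λ _ → refl)) (*ˢ-assoc X P⁺ (E 0))) ⟩
    X *ˢ (P⁺ *ˢ E 0)           ≈⟨ *ˢ-congˡ X (quadratic-fixpoint-unique (P⁺ *ˢ E 0) (Q⁺ *ˢ (𝟏 +ˢ P)) P P⁺ P⁺E₀-quadratic Q⁺[1+P]-quadratic) ⟩
    X *ˢ (Q⁺ *ˢ (𝟏 +ˢ P))      ≈⟨ ≐⇒≈ (≐-sym Q[1+P]≐XQ⁺[1+P]) ⟩
    Q *ˢ (𝟏 +ˢ P)              ∎
  where open ≈-Reasoning (+ 2)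

X*ˢrhs : X *ˢ rhs ≐ X -ˢ P *ˢ P +ˢ (Q *ˢ (𝟏 +ˢ P) +ˢ Q *ˢ (𝟏 +ˢ P))
X*ˢrhs zero    = sym (shiftX≐X*ˢ rhs zero)
X*ˢrhs (suc m) = trans (sym (shiftX≐X*ˢ rhs (suc m)))
  (sym (cong₂ _+_ (cong₂ _-_ (X∘suc≡one m) (P²-coefficient m)) (trans (cong₂ _+_ Q[1+P] Q[1+P]) (sym (double (B m))))))
  where
  X∘suc≡one : ∀ m → X (suc m) ≡ one m
  X∘suc≡one zero    = refl
  X∘suc≡one (suc m) = refl
  double : ∀ b → + 2 * b ≡ b + b
  double = solve-∀
  Q[1+P] : (Q *ˢ (𝟏 +ˢ P)) (suc m) ≡ B m
  Q[1+P] = trans (*ˢ-distribˡ-+ˢ Q 𝟏 P (suc m)) (trans (cong (_+ (Q *ˢ P) (suc m)) (*ˢ-identityʳ Q (suc m))) (Q+QP-coefficient m))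

X*ˢG₁≈X*ˢrhs : X *ˢ G 1 ≈ X *ˢ rhs [mod + 4 ]
X*ˢG₁≈X*ˢrhs = begin
    X *ˢ G 1
  ≈⟨ *ˢ-congˡ X (*ˢ-congˡ C (+ˢ-congˡ 𝟏 (+ˢ-cong wE₁≈E₀ wE₁≈E₀))) ⟩
    X *ˢ (C *ˢ (𝟏 +ˢ (E 0 +ˢ E 0)))
  ≈⟨ solve 3 (λ X C E → (X :* (C :* (con (+ 1) :+ (E :+ E)))) := (X :* C :+ (X :* C :* E :+ X :* C :* E))) ≈-refl X C (E 0) ⟩
    X *ˢ C +ˢ (X *ˢ C *ˢ E 0 +ˢ X *ˢ C *ˢ E 0)
  ≈⟨ +ˢ-cong (≐⇒≈ X*ˢC) (double-lift XCE₀≈Q[1+P]) ⟩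
    X -ˢ P *ˢ P +ˢ (Q *ˢ (𝟏 +ˢ P) +ˢ Q *ˢ (𝟏 +ˢ P))
  ≈⟨ ≐⇒≈ (≐-sym X*ˢrhs) ⟩
    X *ˢ rhs
  ∎
  where
  open ≈-Reasoning (+ 4)
  open Mod4 using (solve; _:+_; _:*_; _:=_; con)
  wE₁≈E₀ : w *ˢ E 1 ≈ E 0 [mod + 4 ]
  wE₁≈E₀ = ≐⇒≈ (≐-sym E₀≐wE₁)

corollary4p1 : Σ Series (λ D → IsXAdicLimit truncCF D × (D ≡ₛ rhs mod4))
corollary4p1 = D , truncCF-converges , λ m → Signed.∣⇒∣ᵤ (∣-difference (coeff D≈rhs m))
  where
  D : Series
  D k = truncCF k k
  D≈rhs : D ≈ rhs [mod + 4 ]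
  D≈rhs = X-cancel (≈-trans (*ˢ-congˡ X (coeffwise truncCF≡G₁)) X*ˢG₁≈X*ˢrhs)
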